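{- For $i=1,2,3$ let $G_{i}$ be an $r_{i}$-regular graph on $n_{i}$ vertices, with adjacency spectra $\{r_{1}=\lambda_{1},\lambda_{2},\ldots,\lambda_{n_{1}}\}$, $\{r_{2}=\mu_{1},\mu_{2},\ldots,\mu_{n_{2}}\}$ and $\{r_{3}=\delta_{1},\delta_{2},\ldots,\delta_{n_{3}}\}$ respectively. Then the distance Laplacian spectrum of $G_{1}\nabla(G_{2}\cup G_{3})$ consists of the eigenvalues $0$, $n_{1}+n_{2}+n_{3}$, $n_{1}+2n_{2}+2n_{3}$, $2n_{1}+n_{2}+n_{3}-r_{1}+\lambda_{j}$ for $j=2,\ldots,n_{1}$, $n_{1}+2n_{2}+2n_{3}-r_{2}+\mu_{j}$ for $j=2,\ldots,n_{2}$, and $n_{1}+2n_{2}+2n_{3}-r_{3}+\delta_{j}$ for $j=2,\ldots,n_{3}$.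
   Context: $G_2\cup G_3$ is the disjoint union; the join $H_1\nabla H_2$ of vertex-disjoint graphs is obtained from $H_1\cup H_2$ by joining every vertex of $H_1$ to every vertex of $H_2$. For a connected graph, $\mathcal{D}$ is its distance matrix, $Tr$ the diagonal matrix of vertex transmissions ($Tr(u)=\sum_v d(u,v)$), and the distance Laplacian matrix is $\mathcal{L}=Tr-\mathcal{D}$. -}

module Defs where

open import Data.Nat using (ℕ; zero; suc)
import Data.Nat as ℕ
open import Data.Integer using (ℤ; +_; -_; _-_) renaming (_+_ to _+ℤ_; _*_ to _*ℤ_)
open import Data.Fin using (Fin; zero; suc; splitAt; punchIn; _≟_)
open import Data.Bool using (Bool; true; false; if_then_else_; _∧_; _∨_)
open import Data.Sum using (inj₁; inj₂)
open import Relation.Nullary using (yes; no)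
open import Relation.Binary.PropositionalEquality using (_≡_)

AdjRel : ℕ → Set
AdjRel n = Fin n → Fin n → Bool

record IsSimple {n : ℕ} (A : AdjRel n) : Set where
  field
    symmetric   : ∀ u v → A u v ≡ A v u
    irreflexive : ∀ u → A u u ≡ false

sumℕ : (n : ℕ) → (Fin n → ℕ) → ℕ
sumℕ zero    f = 0
sumℕ (suc n) f = f zero ℕ.+ sumℕ n (λ i → f (suc i))

sumℤ : (n : ℕ) → (Fin n → ℤ) → ℤ
sumℤ zero    f = + 0
sumℤ (suc n) f = f zero +ℤ sumℤ n (λ i → f (suc i))

anyFin : (n : ℕ) → (Fin n → Bool) → Bool
anyFin zero    f = false
anyFin (suc n) f = f zero ∨ anyFin n (λ i → f (suc i))

b2ℕ : Bool → ℕ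
b2ℕ true  = 1
b2ℕ false = 0

degree : {n : ℕ} → AdjRel n → Fin n → ℕ
degree {n} A u = sumℕ n (λ v → b2ℕ (A u v))

IsRegular : {n : ℕ} → AdjRel n → ℕ → Set
IsRegular A r = ∀ u → degree A u ≡ r

union : {n m : ℕ} → AdjRel n → AdjRel m → AdjRel (n ℕ.+ m)
union {n} A B u v with splitAt n u | splitAt n v
... | inj₁ a | inj₁ b = A a b
... | inj₂ a | inj₂ b = B a b
... | inj₁ _ | inj₂ _ = false
... | inj₂ _ | inj₁ _ = false

join : {n m : ℕ} → AdjRel n → AdjRel m → AdjRel (n ℕ.+ m)
join {n} A B u v with splitAt n u | splitAt n v
... | inj₁ a | inj₁ b = A a b
... | inj₂ a | inj₂ b = B a b
... | inj₁ _ | inj₂ _ = true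
... | inj₂ _ | inj₁ _ = true

eqb : {n : ℕ} → Fin n → Fin n → Bool
eqb u v with u ≟ v
... | yes _ = true
... | no  _ = false

reach : {n : ℕ} → AdjRel n → ℕ → Fin n → Fin n → Bool
reach A zero    u v = eqb u v
reach {n} A (suc k) u v = reach A k u v ∨ anyFin n (λ w → reach A k u w ∧ A w v)

-- graph distance: least k with reach A k u v (searching k = 0 .. n-1;
-- for a connected graph on n vertices the distance is always < n)
dist : {n : ℕ} → AdjRel n → Fin n → Fin n → ℕ
dist {n} A u v = search 0 n
  where
  search : ℕ → ℕ → ℕ
  search k zero    = k
  search k (suc f) = if reach A k u v then k else search (suc k) f

transmission : {n : ℕ} → AdjRel n → Fin n → ℕ
transmission {n} A u = sumℕ n (λ v → dist A u v)

Matrix : ℕ → Set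
Matrix n = Fin n → Fin n → ℤ

adjMatrix : {n : ℕ} → AdjRel n → Matrix n
adjMatrix A u v = + b2ℕ (A u v)

distLaplacian : {n : ℕ} → AdjRel n → Matrix n
distLaplacian A u v = (if eqb u v then + transmission A u else + 0) - + dist A u v

signℤ : ℕ → ℤ
signℤ zero    = + 1
signℤ (suc k) = - signℤ k

det : (n : ℕ) → Matrix n → ℤ
det zero    M = + 1
det (suc n) M = sumℤ (suc n) (λ j →
  signℤ (Data.Fin.toℕ j) *ℤ M zero j *ℤ det n (λ a b → M (suc a) (punchIn j b)))

charPoly : {n : ℕ} → Matrix n → ℤ → ℤ
charPoly {n} M x = det n (λ u v → (if eqb u v then x else + 0) - M u v)

{-# OPTIONS --safe #-}
module Submission where

-- The join G₁ ∇ (G₂ ∪ G₃) has diameter two, so d(u,v) is 1 on edges and 2 on non-edges and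
-- Tr(u) = 2(n − 1) − deg u. Hence x I − L is the block matrix with diagonal blocks
-- (yᵢ I − A(Gᵢ)) + 2J, where yᵢ = x − Pᵢ + rᵢ and Pᵢ is the shift in the statement, and with
-- off-diagonal blocks J (between G₁ and the rest) and 2J (between G₂ and G₃). Each yᵢ I − A(Gᵢ)
-- has constant row sum dᵢ = x − Pᵢ. Subtracting consecutive rows of a block and replacing its
-- columns by prefix sums makes the matrix block triangular: the block collapses to one row and
-- column, at the cost of a factor dᵢ and with a factor det(yᵢ I − A(Gᵢ)) split off. Collapsing
-- all three blocks leaves the 3 × 3 quotient matrix of the partition {V₁, V₂, V₃}, whose
-- determinant is x (x − n) (x − P₂).

open import Defs
open import Data.Nat as ℕ using (ℕ; zero; suc; _≤_; _<_; z≤n; s≤s; _+_; _*_; _≡ᵇ_)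
import Data.Nat.Properties as ℕP
open import Data.Integer as ℤ using (ℤ; +_; -_; _-_) renaming (_+_ to _+ℤ_; _*_ to _*ℤ_)
import Data.Integer.Properties as ℤP
open import Data.Integer.Tactic.RingSolver using (solve-∀)
import Data.Nat.Tactic.RingSolver as ℕSolver
open import Data.Fin as F using (Fin; toℕ; punchIn; _↑ˡ_; _↑ʳ_; splitAt; fromℕ<)
import Data.Fin.Properties as FP
open import Data.Bool using (Bool; true; false; if_then_else_; _∧_; _∨_)
import Data.Bool.Properties as BP
open import Data.Sum using (inj₁; inj₂)
open import Data.Empty using (⊥-elim)
open import Relation.Nullary using (¬_; yes; no)
open import Relation.Binary.PropositionalEquality
open ≡-Reasoning

-- Determinants of matrices indexed by ℕ

-- ∑ and sign are opaque so that unification can still read off summands and indices.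
opaque
  ∑ : ℕ → (ℕ → ℤ) → ℤ
  ∑ zero    f = + 0
  ∑ (suc n) f = f 0 +ℤ ∑ n (λ i → f (suc i))

opaque
  unfolding ∑

  ∑-zero : ∀ (f : ℕ → ℤ) → ∑ 0 f ≡ + 0
  ∑-zero f = refl

  ∑-suc : ∀ n (f : ℕ → ℤ) → ∑ (suc n) f ≡ f 0 +ℤ ∑ n (λ i → f (suc i))
  ∑-suc n f = refl

  ∑-cong : ∀ n {f g : ℕ → ℤ} → (∀ i → i < n → f i ≡ g i) → ∑ n f ≡ ∑ n g
  ∑-cong zero    h = refl
  ∑-cong (suc n) h = cong₂ _+ℤ_ (h 0 (s≤s z≤n)) (∑-cong n (λ i i<n → h (suc i) (s≤s i<n)))

  ∑-+ : ∀ n (f g : ℕ → ℤ) → ∑ n (λ i → f i +ℤ g i) ≡ ∑ n f +ℤ ∑ n g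
  ∑-+ zero    f g = refl
  ∑-+ (suc n) f g rewrite ∑-+ n (λ i → f (suc i)) (λ i → g (suc i)) = interchange (f 0) (g 0) _ _
    where
    interchange : ∀ (a b c d : ℤ) → a +ℤ b +ℤ (c +ℤ d) ≡ a +ℤ c +ℤ (b +ℤ d)
    interchange = solve-∀

  ∑-*ˡ : ∀ n (c : ℤ) (f : ℕ → ℤ) → ∑ n (λ i → c *ℤ f i) ≡ c *ℤ ∑ n f
  ∑-*ˡ zero    c f = sym (ℤP.*-zeroʳ c)
  ∑-*ˡ (suc n) c f rewrite ∑-*ˡ n c (λ i → f (suc i)) = sym (ℤP.*-distribˡ-+ c (f 0) _)

  ∑-neg : ∀ n (f : ℕ → ℤ) → ∑ n (λ i → - f i) ≡ - ∑ n f
  ∑-neg zero    f = refl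
  ∑-neg (suc n) f rewrite ∑-neg n (λ i → f (suc i)) = sym (ℤP.neg-distrib-+ (f 0) _)

  ∑-const : ∀ n (c : ℤ) → ∑ n (λ _ → c) ≡ + n *ℤ c
  ∑-const zero    c = sym (ℤP.*-zeroˡ c)
  ∑-const (suc n) c rewrite ∑-const n c = begin
    c +ℤ + n *ℤ c         ≡⟨ cong (_+ℤ + n *ℤ c) (sym (ℤP.*-identityˡ c)) ⟩
    + 1 *ℤ c +ℤ + n *ℤ c  ≡⟨ sym (ℤP.*-distribʳ-+ c (+ 1) (+ n)) ⟩
    + suc n *ℤ c          ∎

  ∑-split : ∀ a b (f : ℕ → ℤ) → ∑ (a + b) f ≡ ∑ a f +ℤ ∑ b (λ i → f (a + i))
  ∑-split zero    b f = sym (ℤP.+-identityˡ _)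
  ∑-split (suc a) b f rewrite ∑-split a b (λ i → f (suc i)) = sym (ℤP.+-assoc (f 0) _ _)

∑-constant : ∀ n {f : ℕ → ℤ} (c : ℤ) → (∀ i → i < n → f i ≡ c) → ∑ n f ≡ + n *ℤ c
∑-constant n c h = trans (∑-cong n h) (∑-const n c)

∑-vanish : ∀ n {f : ℕ → ℤ} → (∀ i → i < n → f i ≡ + 0) → ∑ n f ≡ + 0
∑-vanish n h = trans (∑-constant n (+ 0) h) (ℤP.*-zeroʳ (+ n))

∑-*ʳ : ∀ n (c : ℤ) (f : ℕ → ℤ) → ∑ n (λ i → f i *ℤ c) ≡ ∑ n f *ℤ c
∑-*ʳ n c f = trans (∑-cong n (λ i _ → ℤP.*-comm (f i) c)) (trans (∑-*ˡ n c f) (ℤP.*-comm c (∑ n f)))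

∑-swap : ∀ n m (f : ℕ → ℕ → ℤ) → ∑ n (λ i → ∑ m (f i)) ≡ ∑ m (λ j → ∑ n (λ i → f i j))
∑-swap zero    m f = trans (∑-zero _) (sym (∑-vanish m (λ j _ → ∑-zero _)))
∑-swap (suc n) m f = begin
  ∑ (suc n) (λ i → ∑ m (f i))                              ≡⟨ ∑-suc n _ ⟩
  ∑ m (f 0) +ℤ ∑ n (λ i → ∑ m (f (suc i)))                 ≡⟨ cong (∑ m (f 0) +ℤ_) (∑-swap n m (λ i → f (suc i))) ⟩
  ∑ m (f 0) +ℤ ∑ m (λ j → ∑ n (λ i → f (suc i) j))         ≡⟨ sym (∑-+ m (f 0) _) ⟩
  ∑ m (λ j → f 0 j +ℤ ∑ n (λ i → f (suc i) j))             ≡⟨ ∑-cong m (λ j _ → sym (∑-suc n (λ i → f i j))) ⟩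
  ∑ m (λ j → ∑ (suc n) (λ i → f i j))                      ∎

∑-last : ∀ n (f : ℕ → ℤ) → ∑ (suc n) f ≡ ∑ n f +ℤ f n
∑-last n f = begin
  ∑ (suc n) f                        ≡⟨ cong (λ m → ∑ m f) (ℕP.+-comm 1 n) ⟩
  ∑ (n + 1) f                        ≡⟨ ∑-split n 1 f ⟩
  ∑ n f +ℤ ∑ 1 (λ i → f (n + i))     ≡⟨ cong (∑ n f +ℤ_) (trans (∑-suc 0 _) (cong₂ _+ℤ_ (cong f (ℕP.+-identityʳ n)) (∑-zero _))) ⟩
  ∑ n f +ℤ (f n +ℤ + 0)              ≡⟨ cong (∑ n f +ℤ_) (ℤP.+-identityʳ (f n)) ⟩
  ∑ n f +ℤ f n                       ∎

opaque
  sign : ℕ → ℤ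
  sign = signℤ

opaque
  unfolding sign

  sign-0 : sign 0 ≡ + 1
  sign-0 = refl

  sign-suc : ∀ j → sign (suc j) ≡ - sign j
  sign-suc j = refl

  signℤ≡sign : ∀ j → signℤ j ≡ sign j
  signℤ≡sign j = refl

-- Matrices are extended to all of ℕ × ℕ so that block indices are plain arithmetic;
-- only the entries below the size passed to det′ matter.
Mat : Set
Mat = ℕ → ℕ → ℤ

punchℕ : ℕ → ℕ → ℕ
punchℕ zero    b       = suc b
punchℕ (suc j) zero    = zero
punchℕ (suc j) (suc b) = suc (punchℕ j b)

minor : ℕ → Mat → Mat
minor j M a b = M (suc a) (punchℕ j b)

det′ : ℕ → Mat → ℤ
det′ zero    M = + 1
det′ (suc n) M = ∑ (suc n) (λ j → sign j *ℤ M 0 j *ℤ det′ n (minor j M))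

expansionTerm : ℕ → Mat → ℕ → ℤ
expansionTerm n M j = sign j *ℤ M 0 j *ℤ det′ n (minor j M)

punchℕ-< : ∀ {n} j b → b < n → punchℕ j b < suc n
punchℕ-< zero    b       b<n       = s≤s b<n
punchℕ-< (suc j) zero    b<n       = s≤s z≤n
punchℕ-< (suc j) (suc b) (s≤s b<n) = s≤s (punchℕ-< j b b<n)

punchℕ-≥ : ∀ j v → j ≤ v → punchℕ j v ≡ suc v
punchℕ-≥ zero    v       _        = refl
punchℕ-≥ (suc j) (suc v) (s≤s le) = cong suc (punchℕ-≥ j v le)

det′-cong : ∀ n {M M′ : Mat} → (∀ a b → a < n → b < n → M a b ≡ M′ a b) → det′ n M ≡ det′ n M′
det′-cong zero    h = refl
det′-cong (suc n) h = ∑-cong (suc n) λ j j<n →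
  cong₂ _*ℤ_ (cong (sign j *ℤ_) (h 0 j (s≤s z≤n) j<n))
             (det′-cong n (λ a b a<n b<n → h (suc a) (punchℕ j b) (s≤s a<n) (punchℕ-< j b b<n)))

sumℤ≡∑ : ∀ n (f : Fin n → ℤ) (g : ℕ → ℤ) → (∀ i → f i ≡ g (toℕ i)) → sumℤ n f ≡ ∑ n g
sumℤ≡∑ zero    f g h = sym (∑-zero g)
sumℤ≡∑ (suc n) f g h = trans (cong₂ _+ℤ_ (h F.zero) (sumℤ≡∑ n _ _ (λ i → h (F.suc i)))) (sym (∑-suc n g))

toℕ-punchIn : ∀ {n} (j : Fin (suc n)) (b : Fin n) → toℕ (punchIn j b) ≡ punchℕ (toℕ j) (toℕ b)
toℕ-punchIn           F.zero    b         = refl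
toℕ-punchIn {suc n} (F.suc j) F.zero    = refl
toℕ-punchIn {suc n} (F.suc j) (F.suc b) = cong suc (toℕ-punchIn j b)

det≡det′ : ∀ n (M : Matrix n) (M′ : Mat) → (∀ i j → M i j ≡ M′ (toℕ i) (toℕ j)) → det n M ≡ det′ n M′
det≡det′ zero    M M′ h = refl
det≡det′ (suc n) M M′ h = sumℤ≡∑ (suc n) _ _ λ j →
  cong₂ _*ℤ_ (cong₂ _*ℤ_ (signℤ≡sign (toℕ j)) (h F.zero j))
             (det≡det′ n _ _ (λ a b → trans (h (F.suc a) (punchIn j b)) (cong (M′ (suc (toℕ a))) (toℕ-punchIn j b))))

_ᵀ : Mat → Mat
(M ᵀ) a b = M b a

TransposeInvariant : ℕ → Set
TransposeInvariant n = ∀ (M : Mat) → det′ n M ≡ det′ n (M ᵀ)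

det′-ᵀ-step : ∀ n → TransposeInvariant n → TransposeInvariant (suc n) → TransposeInvariant (2 + n)
det′-ᵀ-step n ih₀ ih₁ M = begin
    det′ (2 + n) M
  ≡⟨ ∑-suc (suc n) _ ⟩
    sign 0 *ℤ M 0 0 *ℤ det′ (suc n) (minor 0 M) +ℤ ∑ (suc n) (λ j → rowTerm (suc j))
  ≡⟨ cong₂ _+ℤ_ (cong (sign 0 *ℤ M 0 0 *ℤ_) (ih₁ (minor 0 M))) rowTerms≡colTerms ⟩
    sign 0 *ℤ M 0 0 *ℤ det′ (suc n) (minor 0 (M ᵀ)) +ℤ ∑ (suc n) (λ i → colTerm (suc i))
  ≡⟨ sym (∑-suc (suc n) _) ⟩
    det′ (2 + n) (M ᵀ)
  ∎
  where
  rowTerm colTerm : ℕ → ℤ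
  rowTerm = expansionTerm (suc n) M
  colTerm = expansionTerm (suc n) (M ᵀ)

  -- delete rows 0, i+1 and columns 0, j+1
  C : ℕ → ℕ → Mat
  C i j a b = M (suc (punchℕ i a)) (suc (punchℕ j b))

  term : ℕ → ℕ → ℤ
  term i j = sign (suc j) *ℤ M 0 (suc j) *ℤ (sign i *ℤ M (suc i) 0 *ℤ det′ n (C i j))

  term-swap : ∀ i j → term i j ≡ sign (suc i) *ℤ M (suc i) 0 *ℤ (sign j *ℤ M 0 (suc j) *ℤ det′ n (C i j))
  term-swap i j rewrite sign-suc j | sign-suc i = exchange (sign j) (M 0 (suc j)) (sign i) (M (suc i) 0) (det′ n (C i j))
    where
    exchange : ∀ (s a t b D : ℤ) → (- s) *ℤ a *ℤ (t *ℤ b *ℤ D) ≡ (- t) *ℤ b *ℤ (s *ℤ a *ℤ D)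
    exchange = solve-∀

  -- expand the minor of entry (0, j+1) along its first column
  rowTerm-expand : ∀ j → rowTerm (suc j) ≡ ∑ (suc n) (λ i → term i j)
  rowTerm-expand j = begin
    rowTerm (suc j)
      ≡⟨ cong (sign (suc j) *ℤ M 0 (suc j) *ℤ_) (ih₁ (minor (suc j) M)) ⟩
    sign (suc j) *ℤ M 0 (suc j) *ℤ ∑ (suc n) (λ i → sign i *ℤ M (suc i) 0 *ℤ det′ n ((C i j) ᵀ))
      ≡⟨ cong (sign (suc j) *ℤ M 0 (suc j) *ℤ_)
           (∑-cong (suc n) (λ i _ → cong (sign i *ℤ M (suc i) 0 *ℤ_) (sym (ih₀ (C i j))))) ⟩
    sign (suc j) *ℤ M 0 (suc j) *ℤ ∑ (suc n) (λ i → sign i *ℤ M (suc i) 0 *ℤ det′ n (C i j))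
      ≡⟨ sym (∑-*ˡ (suc n) (sign (suc j) *ℤ M 0 (suc j)) (λ i → sign i *ℤ M (suc i) 0 *ℤ det′ n (C i j))) ⟩
    ∑ (suc n) (λ i → term i j)
      ∎

  colTerm-expand : ∀ i → colTerm (suc i) ≡ ∑ (suc n) (λ j → term i j)
  colTerm-expand i = begin
    colTerm (suc i)
      ≡⟨ cong (sign (suc i) *ℤ M (suc i) 0 *ℤ_) (sym (ih₁ (minor (suc i) (M ᵀ) ᵀ))) ⟩
    sign (suc i) *ℤ M (suc i) 0 *ℤ ∑ (suc n) (λ j → sign j *ℤ M 0 (suc j) *ℤ det′ n (C i j))
      ≡⟨ sym (∑-*ˡ (suc n) (sign (suc i) *ℤ M (suc i) 0) (λ j → sign j *ℤ M 0 (suc j) *ℤ det′ n (C i j))) ⟩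
    ∑ (suc n) (λ j → sign (suc i) *ℤ M (suc i) 0 *ℤ (sign j *ℤ M 0 (suc j) *ℤ det′ n (C i j)))
      ≡⟨ ∑-cong (suc n) (λ j _ → sym (term-swap i j)) ⟩
    ∑ (suc n) (λ j → term i j)
      ∎

  rowTerms≡colTerms : ∑ (suc n) (λ j → rowTerm (suc j)) ≡ ∑ (suc n) (λ i → colTerm (suc i))
  rowTerms≡colTerms = begin
    ∑ (suc n) (λ j → rowTerm (suc j))              ≡⟨ ∑-cong (suc n) (λ j _ → rowTerm-expand j) ⟩
    ∑ (suc n) (λ j → ∑ (suc n) (λ i → term i j))   ≡⟨ ∑-swap (suc n) (suc n) (λ j i → term i j) ⟩
    ∑ (suc n) (λ i → ∑ (suc n) (λ j → term i j))   ≡⟨ ∑-cong (suc n) (λ i _ → sym (colTerm-expand i)) ⟩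
    ∑ (suc n) (λ i → colTerm (suc i))              ∎

det′-ᵀ : ∀ n → TransposeInvariant n
det′-ᵀ zero          M = refl
det′-ᵀ (suc zero)    M = ∑-cong 1 λ { zero _ → refl ; (suc _) (s≤s ()) }
det′-ᵀ (suc (suc n))   = det′-ᵀ-step n (det′-ᵀ n) (det′-ᵀ (suc n))

det′-1 : ∀ (M : Mat) → det′ 1 M ≡ M 0 0
det′-1 M = begin
  det′ 1 M                                         ≡⟨ ∑-suc 0 _ ⟩
  sign 0 *ℤ M 0 0 *ℤ + 1 +ℤ ∑ 0 _                  ≡⟨ cong (sign 0 *ℤ M 0 0 *ℤ + 1 +ℤ_) (∑-zero _) ⟩
  sign 0 *ℤ M 0 0 *ℤ + 1 +ℤ + 0                    ≡⟨ ℤP.+-identityʳ _ ⟩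
  sign 0 *ℤ M 0 0 *ℤ + 1                           ≡⟨ ℤP.*-identityʳ _ ⟩
  sign 0 *ℤ M 0 0                                  ≡⟨ cong (_*ℤ M 0 0) sign-0 ⟩
  + 1 *ℤ M 0 0                                     ≡⟨ ℤP.*-identityˡ _ ⟩
  M 0 0                                            ∎

∑-2 : ∀ (f : ℕ → ℤ) → ∑ 2 f ≡ f 0 +ℤ f 1
∑-2 f = trans (∑-suc 1 f) (cong (f 0 +ℤ_) (trans (∑-suc 0 _) (trans (cong (f 1 +ℤ_) (∑-zero _)) (ℤP.+-identityʳ (f 1)))))

∑-3 : ∀ (f : ℕ → ℤ) → ∑ 3 f ≡ f 0 +ℤ (f 1 +ℤ f 2)
∑-3 f = trans (∑-suc 2 f) (cong (f 0 +ℤ_) (∑-2 (λ i → f (suc i))))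

sign-1 : sign 1 ≡ - + 1
sign-1 = trans (sign-suc 0) (cong -_ sign-0)

sign-2 : sign 2 ≡ + 1
sign-2 = trans (sign-suc 1) (cong -_ sign-1)

det′-2 : ∀ (M : Mat) → det′ 2 M ≡ M 0 0 *ℤ M 1 1 - M 0 1 *ℤ M 1 0
det′-2 M = begin
  det′ 2 M
    ≡⟨ ∑-2 (expansionTerm 1 M) ⟩
  sign 0 *ℤ M 0 0 *ℤ det′ 1 (minor 0 M) +ℤ sign 1 *ℤ M 0 1 *ℤ det′ 1 (minor 1 M)
    ≡⟨ cong₂ (λ p q → sign 0 *ℤ M 0 0 *ℤ p +ℤ sign 1 *ℤ M 0 1 *ℤ q) (det′-1 (minor 0 M)) (det′-1 (minor 1 M)) ⟩
  sign 0 *ℤ M 0 0 *ℤ M 1 1 +ℤ sign 1 *ℤ M 0 1 *ℤ M 1 0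
    ≡⟨ cofactors sign-0 sign-1 ⟩
  M 0 0 *ℤ M 1 1 - M 0 1 *ℤ M 1 0
    ∎
  where
  cofactors : ∀ {s₀ s₁ a b c d : ℤ} → s₀ ≡ + 1 → s₁ ≡ - + 1 → s₀ *ℤ a *ℤ b +ℤ s₁ *ℤ c *ℤ d ≡ a *ℤ b - c *ℤ d
  cofactors {a = a} {b} {c} {d} refl refl = polynomial a b c d
    where
    polynomial : ∀ (a b c d : ℤ) → + 1 *ℤ a *ℤ b +ℤ (- + 1) *ℤ c *ℤ d ≡ a *ℤ b - c *ℤ d
    polynomial = solve-∀

det′-3 : ∀ (K : Mat) → det′ 3 K ≡
  K 0 0 *ℤ (K 1 1 *ℤ K 2 2 - K 1 2 *ℤ K 2 1) - K 0 1 *ℤ (K 1 0 *ℤ K 2 2 - K 1 2 *ℤ K 2 0) +ℤ K 0 2 *ℤ (K 1 0 *ℤ K 2 1 - K 1 1 *ℤ K 2 0)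
det′-3 K = begin
  det′ 3 K
    ≡⟨ ∑-3 (expansionTerm 2 K) ⟩
  sign 0 *ℤ K 0 0 *ℤ det′ 2 (minor 0 K) +ℤ (sign 1 *ℤ K 0 1 *ℤ det′ 2 (minor 1 K) +ℤ sign 2 *ℤ K 0 2 *ℤ det′ 2 (minor 2 K))
    ≡⟨ cong₃ (λ p q r → sign 0 *ℤ K 0 0 *ℤ p +ℤ (sign 1 *ℤ K 0 1 *ℤ q +ℤ sign 2 *ℤ K 0 2 *ℤ r))
             (det′-2 (minor 0 K)) (det′-2 (minor 1 K)) (det′-2 (minor 2 K)) ⟩
  sign 0 *ℤ K 0 0 *ℤ m₀ +ℤ (sign 1 *ℤ K 0 1 *ℤ m₁ +ℤ sign 2 *ℤ K 0 2 *ℤ m₂)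
    ≡⟨ cofactors sign-0 sign-1 sign-2 ⟩
  K 0 0 *ℤ m₀ - K 0 1 *ℤ m₁ +ℤ K 0 2 *ℤ m₂
    ∎
  where
  m₀ m₁ m₂ : ℤ
  m₀ = K 1 1 *ℤ K 2 2 - K 1 2 *ℤ K 2 1
  m₁ = K 1 0 *ℤ K 2 2 - K 1 2 *ℤ K 2 0
  m₂ = K 1 0 *ℤ K 2 1 - K 1 1 *ℤ K 2 0

  cong₃ : ∀ (f : ℤ → ℤ → ℤ → ℤ) {p p′ q q′ r r′} → p ≡ p′ → q ≡ q′ → r ≡ r′ → f p q r ≡ f p′ q′ r′
  cong₃ f refl refl refl = refl

  cofactors : ∀ {s₀ s₁ s₂ a b c d e f : ℤ} → s₀ ≡ + 1 → s₁ ≡ - + 1 → s₂ ≡ + 1 →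
    s₀ *ℤ a *ℤ b +ℤ (s₁ *ℤ c *ℤ d +ℤ s₂ *ℤ e *ℤ f) ≡ a *ℤ b - c *ℤ d +ℤ e *ℤ f
  cofactors {a = a} {b} {c} {d} {e} {f} refl refl refl = polynomial a b c d e f
    where
    polynomial : ∀ (a b c d e f : ℤ) → + 1 *ℤ a *ℤ b +ℤ ((- + 1) *ℤ c *ℤ d +ℤ + 1 *ℤ e *ℤ f) ≡ a *ℤ b - c *ℤ d +ℤ e *ℤ f
    polynomial = solve-∀

det′-expand₂ : ∀ n (M : Mat) → det′ (2 + n) M ≡
  expansionTerm (suc n) M 0 +ℤ (expansionTerm (suc n) M 1 +ℤ ∑ n (λ j → expansionTerm (suc n) M (2 + j)))
det′-expand₂ n M = trans (∑-suc (suc n) (expansionTerm (suc n) M))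
  (cong (expansionTerm (suc n) M 0 +ℤ_) (∑-suc n (λ j → expansionTerm (suc n) M (suc j))))

swap : ℕ → ℕ → ℕ
swap zero    zero          = 1
swap zero    (suc zero)    = 0
swap zero    (suc (suc a)) = suc (suc a)
swap (suc k) zero          = zero
swap (suc k) (suc a)       = suc (swap k a)

swap₀-punchℕ : ∀ j b → swap 0 (punchℕ (2 + j) b) ≡ punchℕ (2 + j) (swap 0 b)
swap₀-punchℕ j zero          = refl
swap₀-punchℕ j (suc zero)    = refl
swap₀-punchℕ j (suc (suc b)) = refl

private
  neg-sign : ∀ (s m D : ℤ) → (- s) *ℤ m *ℤ D ≡ - (s *ℤ m *ℤ D)
  neg-sign = solve-∀

  neg-last : ∀ (s m D : ℤ) → s *ℤ m *ℤ (- D) ≡ - (s *ℤ m *ℤ D)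
  neg-last = solve-∀

sign-suc-term : ∀ j (m D : ℤ) → sign (suc j) *ℤ m *ℤ D ≡ - (sign j *ℤ m *ℤ D)
sign-suc-term j m D = trans (cong (λ s → s *ℤ m *ℤ D) (sign-suc j)) (neg-sign (sign j) m D)

sign-term : ∀ j (m D : ℤ) → sign j *ℤ m *ℤ D ≡ - (sign (suc j) *ℤ m *ℤ D)
sign-term j m D = trans (sym (ℤP.neg-involutive _)) (cong -_ (sym (sign-suc-term j m D)))

det′-swapCols₀ : ∀ n (M : Mat) → det′ (2 + n) (λ a b → M a (swap 0 b)) ≡ - det′ (2 + n) M
laterTerms-swapCols₀ : ∀ n (M : Mat) →
  ∑ n (λ j → expansionTerm (suc n) (λ a b → M a (swap 0 b)) (2 + j)) ≡ - ∑ n (λ j → expansionTerm (suc n) M (2 + j))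

det′-swapCols₀ n M = begin
    det′ (2 + n) M′
  ≡⟨ det′-expand₂ n M′ ⟩
    term M′ 0 +ℤ (term M′ 1 +ℤ ∑ n (λ j → term M′ (2 + j)))
  ≡⟨ cong₂ _+ℤ_ first (cong₂ _+ℤ_ second (laterTerms-swapCols₀ n M)) ⟩
    - term M 1 +ℤ (- term M 0 +ℤ - ∑ n (λ j → term M (2 + j)))
  ≡⟨ exchange (term M 0) (term M 1) _ ⟩
    - (term M 0 +ℤ (term M 1 +ℤ ∑ n (λ j → term M (2 + j))))
  ≡⟨ cong -_ (sym (det′-expand₂ n M)) ⟩
    - det′ (2 + n) M
  ∎
  where
  M′ : Mat
  M′ a b = M a (swap 0 b)

  term : Mat → ℕ → ℤ
  term = expansionTerm (suc n)

  exchange : ∀ (a b c : ℤ) → - b +ℤ (- a +ℤ - c) ≡ - (a +ℤ (b +ℤ c))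
  exchange = solve-∀

  first : term M′ 0 ≡ - term M 1
  first = trans (cong (sign 0 *ℤ M 0 1 *ℤ_) (det′-cong (suc n) {minor 0 M′} {minor 1 M} λ { a zero _ _ → refl ; a (suc b) _ _ → refl }))
                (sign-term 0 (M 0 1) (det′ (suc n) (minor 1 M)))

  second : term M′ 1 ≡ - term M 0
  second = trans (cong (sign 1 *ℤ M 0 0 *ℤ_) (det′-cong (suc n) {minor 1 M′} {minor 0 M} λ { a zero _ _ → refl ; a (suc b) _ _ → refl }))
                 (sign-suc-term 0 (M 0 0) (det′ (suc n) (minor 0 M)))

laterTerms-swapCols₀ zero    M = trans (∑-zero _) (sym (cong -_ (∑-zero _)))
laterTerms-swapCols₀ (suc n) M = trans (∑-cong (suc n) swapped) (∑-neg (suc n) _)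
  where
  swapped : ∀ j → j < suc n → expansionTerm (2 + n) (λ a b → M a (swap 0 b)) (2 + j) ≡ - expansionTerm (2 + n) M (2 + j)
  swapped j _ = begin
    sign (2 + j) *ℤ M 0 (2 + j) *ℤ det′ (2 + n) (λ a b → M (suc a) (swap 0 (punchℕ (2 + j) b)))
      ≡⟨ cong (sign (2 + j) *ℤ M 0 (2 + j) *ℤ_) (det′-cong (2 + n) (λ a b _ _ → cong (M (suc a)) (swap₀-punchℕ j b))) ⟩
    sign (2 + j) *ℤ M 0 (2 + j) *ℤ det′ (2 + n) (λ a b → minor (2 + j) M a (swap 0 b))
      ≡⟨ cong (sign (2 + j) *ℤ M 0 (2 + j) *ℤ_) (det′-swapCols₀ n (minor (2 + j) M)) ⟩
    sign (2 + j) *ℤ M 0 (2 + j) *ℤ - det′ (2 + n) (minor (2 + j) M)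
      ≡⟨ neg-last (sign (2 + j)) (M 0 (2 + j)) _ ⟩
    - expansionTerm (2 + n) M (2 + j)
      ∎

det′-swapRows : ∀ n k (M : Mat) → suc k < n → det′ n (λ a b → M (swap k a) b) ≡ - det′ n M
det′-swapRows (suc (suc n)) zero M _ = begin
  det′ (2 + n) (λ a b → M (swap 0 a) b)   ≡⟨ det′-ᵀ (2 + n) (λ a b → M (swap 0 a) b) ⟩
  det′ (2 + n) (λ a b → M (swap 0 b) a)   ≡⟨ det′-swapCols₀ n (M ᵀ) ⟩
  - det′ (2 + n) (M ᵀ)                     ≡⟨ cong -_ (sym (det′-ᵀ (2 + n) M)) ⟩
  - det′ (2 + n) M                         ∎
det′-swapRows (suc n) (suc k) M (s≤s k<n) = trans (∑-cong (suc n) swapped) (∑-neg (suc n) _)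
  where
  swapped : ∀ j → j < suc n → expansionTerm n (λ a b → M (swap (suc k) a) b) j ≡ - expansionTerm n M j
  swapped j _ = trans (cong (sign j *ℤ M 0 j *ℤ_) (det′-swapRows n k (minor j M) k<n))
                      (neg-last (sign j) (M 0 j) _)

x≡-x⇒x≡0 : ∀ (x : ℤ) → x ≡ - x → x ≡ + 0
x≡-x⇒x≡0 (+ zero)     _ = refl
x≡-x⇒x≡0 (+ suc n)    ()
x≡-x⇒x≡0 (ℤ.-[1+ n ]) ()

swapRows-equal : ∀ k (M : Mat) → (∀ b → M k b ≡ M (suc k) b) → ∀ a b → M (swap k a) b ≡ M a b
swapRows-equal zero    M h zero          b = sym (h b)
swapRows-equal zero    M h (suc zero)    b = h b
swapRows-equal zero    M h (suc (suc a)) b = refl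
swapRows-equal (suc k) M h zero          b = refl
swapRows-equal (suc k) M h (suc a)       b = swapRows-equal k (λ a b → M (suc a) b) h a b

det′-equalRows : ∀ n k (M : Mat) → suc k < n → (∀ b → M k b ≡ M (suc k) b) → det′ n M ≡ + 0
det′-equalRows n k M lt h = x≡-x⇒x≡0 (det′ n M) (begin
  det′ n M                              ≡⟨ sym (det′-cong n (λ a b _ _ → swapRows-equal k M h a b)) ⟩
  det′ n (λ a b → M (swap k a) b)       ≡⟨ det′-swapRows n k M lt ⟩
  - det′ n M                            ∎)

replaceRow : ℕ → (ℕ → ℤ) → Mat → Mat
replaceRow k R M a b = if a ≡ᵇ k then R b else M a b

addToRow : ℕ → (ℕ → ℤ) → Mat → Mat
addToRow k R M a b = if a ≡ᵇ k then M a b +ℤ R b else M a b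

addToCol : ℕ → (ℕ → ℤ) → Mat → Mat
addToCol k C M = addToRow k C (M ᵀ) ᵀ

det′-addToRow-linear : ∀ n k (M : Mat) (Y : ℕ → ℤ) (c : ℤ) → k < n →
  det′ n (addToRow k (λ b → c *ℤ Y b) M) ≡ det′ n M +ℤ c *ℤ det′ n (replaceRow k Y M)
det′-addToRow-linear (suc n) zero M Y c _ = begin
  ∑ (suc n) (λ j → sign j *ℤ (M 0 j +ℤ c *ℤ Y j) *ℤ D j)
    ≡⟨ ∑-cong (suc n) (λ j _ → distrib (sign j) (M 0 j) c (Y j) (D j)) ⟩
  ∑ (suc n) (λ j → expansionTerm n M j +ℤ c *ℤ (sign j *ℤ Y j *ℤ D j))
    ≡⟨ ∑-+ (suc n) _ _ ⟩
  det′ (suc n) M +ℤ ∑ (suc n) (λ j → c *ℤ (sign j *ℤ Y j *ℤ D j))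
    ≡⟨ cong (det′ (suc n) M +ℤ_) (∑-*ˡ (suc n) c _) ⟩
  det′ (suc n) M +ℤ c *ℤ det′ (suc n) (replaceRow 0 Y M)
    ∎
  where
  D : ℕ → ℤ
  D j = det′ n (minor j M)
  distrib : ∀ (s m c y D : ℤ) → s *ℤ (m +ℤ c *ℤ y) *ℤ D ≡ s *ℤ m *ℤ D +ℤ c *ℤ (s *ℤ y *ℤ D)
  distrib = solve-∀
det′-addToRow-linear (suc n) (suc k) M Y c (s≤s k<n) = begin
  ∑ (suc n) (λ j → sign j *ℤ M 0 j *ℤ det′ n (addToRow k (λ b → c *ℤ Y (punchℕ j b)) (minor j M)))
    ≡⟨ ∑-cong (suc n) (λ j _ → cong (sign j *ℤ M 0 j *ℤ_) (det′-addToRow-linear n k (minor j M) (λ b → Y (punchℕ j b)) c k<n)) ⟩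
  ∑ (suc n) (λ j → sign j *ℤ M 0 j *ℤ (det′ n (minor j M) +ℤ c *ℤ E j))
    ≡⟨ ∑-cong (suc n) (λ j _ → distrib (sign j) (M 0 j) (det′ n (minor j M)) c (E j)) ⟩
  ∑ (suc n) (λ j → expansionTerm n M j +ℤ c *ℤ (sign j *ℤ M 0 j *ℤ E j))
    ≡⟨ ∑-+ (suc n) _ _ ⟩
  det′ (suc n) M +ℤ ∑ (suc n) (λ j → c *ℤ (sign j *ℤ M 0 j *ℤ E j))
    ≡⟨ cong (det′ (suc n) M +ℤ_) (∑-*ˡ (suc n) c _) ⟩
  det′ (suc n) M +ℤ c *ℤ det′ (suc n) (replaceRow (suc k) Y M)
    ∎
  where
  E : ℕ → ℤ
  E j = det′ n (replaceRow k (λ b → Y (punchℕ j b)) (minor j M))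
  distrib : ∀ (s m D c E : ℤ) → s *ℤ m *ℤ (D +ℤ c *ℤ E) ≡ s *ℤ m *ℤ D +ℤ c *ℤ (s *ℤ m *ℤ E)
  distrib = solve-∀

≡ᵇ-refl : ∀ k → (k ≡ᵇ k) ≡ true
≡ᵇ-refl zero    = refl
≡ᵇ-refl (suc k) = ≡ᵇ-refl k

≡ᵇ-≢ : ∀ a b → ¬ (a ≡ b) → (a ≡ᵇ b) ≡ false
≡ᵇ-≢ zero    zero    ne = ⊥-elim (ne refl)
≡ᵇ-≢ zero    (suc b) ne = refl
≡ᵇ-≢ (suc a) zero    ne = refl
≡ᵇ-≢ (suc a) (suc b) ne = ≡ᵇ-≢ a b (λ e → ne (cong suc e))

det′-addToRow-copy : ∀ n k l (M : Mat) (c : ℤ) → k < n →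
  det′ n (replaceRow k (M l) M) ≡ + 0 → det′ n (addToRow k (λ b → c *ℤ M l b) M) ≡ det′ n M
det′-addToRow-copy n k l M c k<n copy≡0 = begin
  det′ n (addToRow k (λ b → c *ℤ M l b) M)            ≡⟨ det′-addToRow-linear n k M (M l) c k<n ⟩
  det′ n M +ℤ c *ℤ det′ n (replaceRow k (M l) M)      ≡⟨ cong (λ z → det′ n M +ℤ c *ℤ z) copy≡0 ⟩
  det′ n M +ℤ c *ℤ + 0                                ≡⟨ cong (det′ n M +ℤ_) (ℤP.*-zeroʳ c) ⟩
  det′ n M +ℤ + 0                                     ≡⟨ ℤP.+-identityʳ _ ⟩
  det′ n M                                            ∎

det′-addNextRow : ∀ n k (M : Mat) (c : ℤ) → suc k < n → det′ n (addToRow k (λ b → c *ℤ M (suc k) b) M) ≡ det′ n M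
det′-addNextRow n k M c lt = det′-addToRow-copy n k (suc k) M c (ℕP.<-trans (ℕP.n<1+n k) lt)
  (det′-equalRows n k (replaceRow k (M (suc k)) M) lt λ b →
    trans (cong (λ z → if z then M (suc k) b else M k b) (≡ᵇ-refl k))
          (cong (λ z → if z then M (suc k) b else M (suc k) b) (sym (≡ᵇ-≢ (suc k) k (ℕP.1+n≢n)))))

det′-addPrevRow : ∀ n k (M : Mat) (c : ℤ) → suc k < n → det′ n (addToRow (suc k) (λ b → c *ℤ M k b) M) ≡ det′ n M
det′-addPrevRow n k M c lt = det′-addToRow-copy n (suc k) k M c lt
  (det′-equalRows n k (replaceRow (suc k) (M k) M) lt λ b →
    trans (cong (λ z → if z then M k b else M k b) (≡ᵇ-≢ k (suc k) (λ e → ℕP.1+n≢n (sym e))))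
          (cong (λ z → if z then M k b else M (suc k) b) (sym (≡ᵇ-refl (suc k)))))

det′-addPrevCol : ∀ n k (M : Mat) (c : ℤ) → suc k < n → det′ n (addToCol (suc k) (λ a → c *ℤ M a k) M) ≡ det′ n M
det′-addPrevCol n k M c lt = begin
  det′ n (addToCol (suc k) (λ a → c *ℤ M a k) M)       ≡⟨ det′-ᵀ n _ ⟩
  det′ n (addToRow (suc k) (λ a → c *ℤ M a k) (M ᵀ))   ≡⟨ det′-addPrevRow n k (M ᵀ) c lt ⟩
  det′ n (M ᵀ)                                         ≡⟨ sym (det′-ᵀ n M) ⟩
  det′ n M                                             ∎

det′-blockTriangular : ∀ b c (M : Mat) → (∀ u v → u < b → b ≤ v → v < b + c → M u v ≡ + 0) →
  det′ (b + c) M ≡ det′ b M *ℤ det′ c (λ u v → M (b + u) (b + v))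
det′-blockTriangular zero    c M _ = sym (ℤP.*-identityˡ _)
det′-blockTriangular (suc b) c M upperRight≡0 = begin
  ∑ (suc b + c) (expansionTerm (b + c) M)
    ≡⟨ ∑-split (suc b) c _ ⟩
  ∑ (suc b) (expansionTerm (b + c) M) +ℤ ∑ c (λ i → expansionTerm (b + c) M (suc b + i))
    ≡⟨ cong₂ _+ℤ_ (∑-cong (suc b) leftTerm) (∑-vanish c rightTerm) ⟩
  ∑ (suc b) (λ j → expansionTerm b M j *ℤ Dc) +ℤ + 0
    ≡⟨ ℤP.+-identityʳ _ ⟩
  ∑ (suc b) (λ j → expansionTerm b M j *ℤ Dc)
    ≡⟨ ∑-*ʳ (suc b) Dc _ ⟩
  det′ (suc b) M *ℤ Dc
    ∎
  where
  Dc : ℤ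
  Dc = det′ c (λ u v → M (suc b + u) (suc b + v))

  rightTerm : ∀ i → i < c → expansionTerm (b + c) M (suc b + i) ≡ + 0
  rightTerm i i<c = begin
    sign (suc b + i) *ℤ M 0 (suc b + i) *ℤ det′ (b + c) (minor (suc b + i) M)
      ≡⟨ cong (λ z → sign (suc b + i) *ℤ z *ℤ det′ (b + c) (minor (suc b + i) M))
              (upperRight≡0 0 (suc b + i) (s≤s z≤n) (ℕP.m≤m+n (suc b) i) (ℕP.+-monoʳ-< (suc b) i<c)) ⟩
    sign (suc b + i) *ℤ + 0 *ℤ det′ (b + c) (minor (suc b + i) M)
      ≡⟨ cong (_*ℤ det′ (b + c) (minor (suc b + i) M)) (ℤP.*-zeroʳ (sign (suc b + i))) ⟩
    + 0 *ℤ det′ (b + c) (minor (suc b + i) M)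
      ≡⟨ ℤP.*-zeroˡ (det′ (b + c) (minor (suc b + i) M)) ⟩
    + 0
      ∎

  leftTerm : ∀ j → j < suc b → expansionTerm (b + c) M j ≡ expansionTerm b M j *ℤ Dc
  leftTerm j (s≤s j≤b) = begin
    sign j *ℤ M 0 j *ℤ det′ (b + c) (minor j M)
      ≡⟨ cong (sign j *ℤ M 0 j *ℤ_) (det′-blockTriangular b c (minor j M) minorUpperRight≡0) ⟩
    sign j *ℤ M 0 j *ℤ (det′ b (minor j M) *ℤ det′ c (λ u v → minor j M (b + u) (b + v)))
      ≡⟨ cong (λ z → sign j *ℤ M 0 j *ℤ (det′ b (minor j M) *ℤ z))
              (det′-cong c (λ u v _ _ → cong (M (suc (b + u))) (punchℕ-≥ j (b + v) (ℕP.≤-trans j≤b (ℕP.m≤m+n b v))))) ⟩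
    sign j *ℤ M 0 j *ℤ (det′ b (minor j M) *ℤ Dc)
      ≡⟨ sym (ℤP.*-assoc (sign j *ℤ M 0 j) _ Dc) ⟩
    expansionTerm b M j *ℤ Dc
      ∎
    where
    minorUpperRight≡0 : ∀ u v → u < b → b ≤ v → v < b + c → minor j M u v ≡ + 0
    minorUpperRight≡0 u v u<b b≤v v<b+c = trans (cong (M (suc u)) (punchℕ-≥ j v (ℕP.≤-trans j≤b b≤v)))
      (upperRight≡0 (suc u) (suc v) (s≤s u<b) (s≤s b≤v) (s≤s v<b+c))

det′-conjSwap : ∀ n k (M : Mat) → suc k < n → det′ n (λ a b → M (swap k a) (swap k b)) ≡ det′ n M
det′-conjSwap n k M lt = begin
  det′ n (λ a b → M (swap k a) (swap k b))     ≡⟨ det′-swapRows n k (λ a b → M a (swap k b)) lt ⟩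
  - det′ n (λ a b → M a (swap k b))            ≡⟨ cong -_ (det′-ᵀ n (λ a b → M a (swap k b))) ⟩
  - det′ n (λ a b → M b (swap k a))            ≡⟨ cong -_ (det′-swapRows n k (M ᵀ) lt) ⟩
  - - det′ n (M ᵀ)                             ≡⟨ ℤP.neg-involutive _ ⟩
  det′ n (M ᵀ)                                 ≡⟨ sym (det′-ᵀ n M) ⟩
  det′ n M                                     ∎

-- the cycle j ↦ 0, a ↦ a + 1 for a < j, fixing every a > j
rotate : ℕ → ℕ → ℕ
rotate zero    a = a
rotate (suc j) a = rotate j (swap j a)

det′-conjRotate : ∀ j n (M : Mat) → j < n → det′ n (λ a b → M (rotate j a) (rotate j b)) ≡ det′ n M
det′-conjRotate zero    n M _  = refl
det′-conjRotate (suc j) n M lt = trans (det′-conjSwap n j (λ a b → M (rotate j a) (rotate j b)) lt)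
                                       (det′-conjRotate j n M (ℕP.<-trans (ℕP.n<1+n j) lt))

-- Collapsing a block with constant row sums

∑-offset : ∀ m {f g : ℕ → ℤ} (α : ℤ) → (∀ t → t < m → f t ≡ g t +ℤ α) → ∑ m f ≡ ∑ m g +ℤ + m *ℤ α
∑-offset m {f} {g} α h = trans (∑-cong m h) (trans (∑-+ m g (λ _ → α)) (cong (∑ m g +ℤ_) (∑-const m α)))

prefixCols : ℕ → Mat → Mat
prefixCols zero    N = N
prefixCols (suc j) N = addToCol (suc j) (λ a → + 1 *ℤ prefixCols j N a j) (prefixCols j N)

prefixCols-> : ∀ j (N : Mat) a v → j < v → prefixCols j N a v ≡ N a v
prefixCols-> zero    N a v _ = refl
prefixCols-> (suc j) N a v lt rewrite ≡ᵇ-≢ v (suc j) (ℕP.>⇒≢ lt) = prefixCols-> j N a v (ℕP.<-trans (ℕP.n<1+n j) lt)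

prefixCols-≤ : ∀ j (N : Mat) a v → v ≤ j → prefixCols j N a v ≡ ∑ (suc v) (N a)
prefixCols-≤ zero N a zero _ = sym (trans (∑-suc 0 (N a)) (trans (cong (N a 0 +ℤ_) (∑-zero _)) (ℤP.+-identityʳ _)))
prefixCols-≤ (suc j) N a v le with v ℕP.≟ suc j
... | yes refl rewrite ≡ᵇ-refl j | prefixCols-> j N a (suc j) (ℕP.n<1+n j) | prefixCols-≤ j N a j ℕP.≤-refl = begin
  N a (suc j) +ℤ + 1 *ℤ ∑ (suc j) (N a)   ≡⟨ cong (N a (suc j) +ℤ_) (ℤP.*-identityˡ _) ⟩
  N a (suc j) +ℤ ∑ (suc j) (N a)          ≡⟨ ℤP.+-comm (N a (suc j)) _ ⟩
  ∑ (suc j) (N a) +ℤ N a (suc j)          ≡⟨ sym (∑-last (suc j) (N a)) ⟩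
  ∑ (2 + j) (N a)                         ∎
... | no ne rewrite ≡ᵇ-≢ v (suc j) ne = prefixCols-≤ j N a v (ℕP.≤-pred (ℕP.≤∧≢⇒< le ne))

det′-prefixCols : ∀ n j (N : Mat) → j < n → det′ n (prefixCols j N) ≡ det′ n N
det′-prefixCols n zero    N _  = refl
det′-prefixCols n (suc j) N lt = trans (det′-addPrevCol n j (prefixCols j N) (+ 1) lt)
                                       (det′-prefixCols n j N (ℕP.<-trans (ℕP.n<1+n j) lt))

diffRows : ℕ → Mat → Mat
diffRows zero    X = X
diffRows (suc i) X = addToRow i (λ c → (- + 1) *ℤ diffRows i X (suc i) c) (diffRows i X)

diffRows-≥ : ∀ i (X : Mat) a c → i ≤ a → diffRows i X a c ≡ X a c
diffRows-≥ zero    X a c _  = refl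
diffRows-≥ (suc i) X a c le rewrite ≡ᵇ-≢ a i (ℕP.>⇒≢ le) = diffRows-≥ i X a c (ℕP.<⇒≤ le)

diffRows-< : ∀ i (X : Mat) a c → a < i → diffRows i X a c ≡ X a c +ℤ (- + 1) *ℤ X (suc a) c
diffRows-< (suc i) X a c lt with a ℕP.≟ i
... | yes refl rewrite ≡ᵇ-refl a | diffRows-≥ a X a c ℕP.≤-refl | diffRows-≥ a X (suc a) c (ℕP.n≤1+n a) = refl
... | no ne rewrite ≡ᵇ-≢ a i ne = diffRows-< i X a c (ℕP.≤∧≢⇒< (ℕP.≤-pred lt) ne)

det′-diffRows : ∀ n i (X : Mat) → i < n → det′ n (diffRows i X) ≡ det′ n X
det′-diffRows n zero    X _  = refl
det′-diffRows n (suc i) X lt = trans (det′-addNextRow n i (diffRows i X) (- + 1) lt)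
                                     (det′-diffRows n i X (ℕP.<-trans (ℕP.n<1+n i) lt))

-- Row a of the block 0..b becomes (prefix sums of row a) − (prefix sums of row a + 1); the
-- block's last column thus holds differences of row sums.
reduced : ℕ → Mat → Mat
reduced b N = diffRows b (prefixCols b N)

private
  x-x≡0 : ∀ (x : ℤ) → x +ℤ (- + 1) *ℤ x ≡ + 0
  x-x≡0 = solve-∀

reduced-<-≤ : ∀ b (N : Mat) u v → u < b → v ≤ b → reduced b N u v ≡ ∑ (suc v) (N u) +ℤ (- + 1) *ℤ ∑ (suc v) (N (suc u))
reduced-<-≤ b N u v u<b v≤b = trans (diffRows-< b (prefixCols b N) u v u<b)
  (cong₂ (λ x y → x +ℤ (- + 1) *ℤ y) (prefixCols-≤ b N u v v≤b) (prefixCols-≤ b N (suc u) v v≤b))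

reduced-<-> : ∀ b (N : Mat) u v → u < b → b < v → reduced b N u v ≡ N u v +ℤ (- + 1) *ℤ N (suc u) v
reduced-<-> b N u v u<b b<v = trans (diffRows-< b (prefixCols b N) u v u<b)
  (cong₂ (λ x y → x +ℤ (- + 1) *ℤ y) (prefixCols-> b N u v b<v) (prefixCols-> b N (suc u) v b<v))

reduced-≥-≤ : ∀ b (N : Mat) u v → b ≤ u → v ≤ b → reduced b N u v ≡ ∑ (suc v) (N u)
reduced-≥-≤ b N u v b≤u v≤b = trans (diffRows-≥ b (prefixCols b N) u v b≤u) (prefixCols-≤ b N u v v≤b)

reduced-≥-> : ∀ b (N : Mat) u v → b ≤ u → b < v → reduced b N u v ≡ N u v
reduced-≥-> b N u v b≤u b<v = trans (diffRows-≥ b (prefixCols b N) u v b≤u) (prefixCols-> b N u v b<v)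

det′-reduced-split : ∀ b k (N : Mat) → (∀ u v → u < b → b ≤ v → v < b + suc k → reduced b N u v ≡ + 0) →
  det′ (suc b + k) N ≡ det′ b (reduced b N) *ℤ det′ (suc k) (λ u v → reduced b N (b + u) (b + v))
det′-reduced-split b k N upperRight≡0 = begin
  det′ (suc b + k) N                 ≡⟨ sym (det′-prefixCols (suc b + k) b N b<n) ⟩
  det′ (suc b + k) (prefixCols b N)  ≡⟨ sym (det′-diffRows (suc b + k) b (prefixCols b N) b<n) ⟩
  det′ (suc b + k) (reduced b N)     ≡⟨ cong (λ m → det′ m (reduced b N)) (sym (ℕP.+-suc b k)) ⟩
  det′ (b + suc k) (reduced b N)     ≡⟨ det′-blockTriangular b (suc k) (reduced b N) upperRight≡0 ⟩
  det′ b (reduced b N) *ℤ det′ (suc k) (λ u v → reduced b N (b + u) (b + v)) ∎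
  where
  b<n : b < suc b + k
  b<n = s≤s (ℕP.m≤m+n b k)

det′-reduced-rowSums : ∀ b (B : Mat) (d : ℤ) → (∀ u → u < suc b → ∑ (suc b) (B u) ≡ d) →
  det′ b (reduced b B) *ℤ d ≡ det′ (suc b) B
det′-reduced-rowSums b B d rowSums = sym (begin
  det′ (suc b) B
    ≡⟨ cong (λ m → det′ m B) (sym (ℕP.+-identityʳ (suc b))) ⟩
  det′ (suc b + 0) B
    ≡⟨ det′-reduced-split b 0 B lastCol≡0 ⟩
  det′ b (reduced b B) *ℤ det′ 1 (λ u v → reduced b B (b + u) (b + v))
    ≡⟨ cong (det′ b (reduced b B) *ℤ_) corner ⟩
  det′ b (reduced b B) *ℤ d ∎)
  where
  lastCol≡0 : ∀ u v → u < b → b ≤ v → v < b + 1 → reduced b B u v ≡ + 0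
  lastCol≡0 u v u<b b≤v v<b+1 with ℕP.≤-antisym b≤v (ℕP.≤-pred (subst (v <_) (ℕP.+-comm b 1) v<b+1))
  ... | refl = begin
    reduced b B u b                                                  ≡⟨ reduced-<-≤ b B u b u<b ℕP.≤-refl ⟩
    ∑ (suc b) (B u) +ℤ (- + 1) *ℤ ∑ (suc b) (B (suc u))              ≡⟨ cong₂ (λ x y → x +ℤ (- + 1) *ℤ y) (rowSums u (ℕP.<-trans u<b (ℕP.n<1+n b))) (rowSums (suc u) (s≤s u<b)) ⟩
    d +ℤ (- + 1) *ℤ d                                                ≡⟨ x-x≡0 d ⟩
    + 0                                                              ∎
  corner : det′ 1 (λ u v → reduced b B (b + u) (b + v)) ≡ d
  corner = begin
    det′ 1 (λ u v → reduced b B (b + u) (b + v))   ≡⟨ det′-1 (λ u v → reduced b B (b + u) (b + v)) ⟩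
    reduced b B (b + 0) (b + 0)                    ≡⟨ cong₂ (reduced b B) (ℕP.+-identityʳ b) (ℕP.+-identityʳ b) ⟩
    reduced b B b b                                ≡⟨ reduced-≥-≤ b B b b ℕP.≤-refl ℕP.≤-refl ⟩
    ∑ (suc b) (B b)                                ≡⟨ rowSums b ℕP.≤-refl ⟩
    d                                              ∎

swap-< : ∀ j a → a < j → swap j a ≡ a
swap-< (suc j) zero    _        = refl
swap-< (suc j) (suc a) (s≤s lt) = cong suc (swap-< j a lt)

swap-≡ : ∀ j → swap j j ≡ suc j
swap-≡ zero    = refl
swap-≡ (suc j) = cong suc (swap-≡ j)

swap-suc : ∀ j → swap j (suc j) ≡ j
swap-suc zero    = refl
swap-suc (suc j) = cong suc (swap-suc j)

swap-> : ∀ j a → suc j < a → swap j a ≡ a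
swap-> zero    (suc (suc a)) _        = refl
swap-> zero    (suc zero)    (s≤s ())
swap-> (suc j) (suc a)       (s≤s lt) = cong suc (swap-> j a lt)

rotate-> : ∀ j a → j < a → rotate j a ≡ a
rotate-> zero    a _  = refl
rotate-> (suc j) a lt = trans (cong (rotate j) (swap-> j a lt)) (rotate-> j a (ℕP.<-trans (ℕP.n<1+n j) lt))

rotate-≡ : ∀ j → rotate j j ≡ 0
rotate-≡ zero    = refl
rotate-≡ (suc j) = trans (cong (rotate j) (swap-suc j)) (rotate-≡ j)

rotate-< : ∀ j a → a < j → rotate j a ≡ suc a
rotate-< (suc j) a (s≤s le) with a ℕP.≟ j
... | yes refl = trans (cong (rotate a) (swap-≡ a)) (rotate-> a (suc a) (ℕP.n<1+n a))
... | no ne    = trans (cong (rotate j) (swap-< j a (ℕP.≤∧≢⇒< le ne))) (rotate-< j a (ℕP.≤∧≢⇒< le ne))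

-- Rows and columns 0..b of N are collapsed into the single last index k; the indices 0..k−1
-- are the remaining rows and columns b+1..b+k of N, in order.
collapse : ℕ → ℕ → Mat → Mat
collapse b k N u v = reduced b N (b + rotate k u) (b + rotate k v)

collapse-inner : ∀ b k N u v → u < k → v < k → collapse b k N u v ≡ N (suc b + u) (suc b + v)
collapse-inner b k N u v u<k v<k rewrite rotate-< k u u<k | rotate-< k v v<k | ℕP.+-suc b u | ℕP.+-suc b v
  = reduced-≥-> b N (suc (b + u)) (suc (b + v)) (ℕP.≤-trans (ℕP.m≤m+n b u) (ℕP.n≤1+n _)) (s≤s (ℕP.m≤m+n b v))

collapse-inner-last : ∀ b k N u → u < k → collapse b k N u k ≡ ∑ (suc b) (N (suc b + u))
collapse-inner-last b k N u u<k rewrite rotate-< k u u<k | rotate-≡ k | ℕP.+-suc b u | ℕP.+-identityʳ b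
  = reduced-≥-≤ b N (suc (b + u)) b (ℕP.≤-trans (ℕP.m≤m+n b u) (ℕP.n≤1+n _)) ℕP.≤-refl

collapse-last-inner : ∀ b k N v → v < k → collapse b k N k v ≡ N b (suc b + v)
collapse-last-inner b k N v v<k rewrite rotate-< k v v<k | rotate-≡ k | ℕP.+-suc b v | ℕP.+-identityʳ b
  = reduced-≥-> b N b (suc (b + v)) ℕP.≤-refl (s≤s (ℕP.m≤m+n b v))

collapse-last-last : ∀ b k N → collapse b k N k k ≡ ∑ (suc b) (N b)
collapse-last-last b k N rewrite rotate-≡ k | ℕP.+-identityʳ b = reduced-≥-≤ b N b b ℕP.≤-refl ℕP.≤-refl

-- After `reduced` the matrix is block triangular, and the top-left block is the one obtained
-- from B, since the constant α cancels.
det′-collapse : ∀ b k (N B : Mat) (α d : ℤ) →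
  (∀ u w → u < b → w < k → N u (suc b + w) ≡ N (suc u) (suc b + w)) →
  (∀ u v → u < suc b → v < suc b → N u v ≡ B u v +ℤ α) →
  (∀ u → u < suc b → ∑ (suc b) (B u) ≡ d) →
  det′ (suc b + k) N *ℤ d ≡ det′ (suc b) B *ℤ det′ (suc k) (collapse b k N)
det′-collapse b k N B α d equalRows offset rowSums = begin
  det′ (suc b + k) N *ℤ d
    ≡⟨ cong (_*ℤ d) (det′-reduced-split b k N upperRight≡0) ⟩
  det′ b (reduced b N) *ℤ det′ (suc k) (λ u v → reduced b N (b + u) (b + v)) *ℤ d
    ≡⟨ cong₂ (λ x y → x *ℤ y *ℤ d) (det′-cong b topLeft) (sym (det′-conjRotate k (suc k) (λ u v → reduced b N (b + u) (b + v)) (ℕP.n<1+n k))) ⟩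
  det′ b (reduced b B) *ℤ det′ (suc k) (collapse b k N) *ℤ d
    ≡⟨ exchange (det′ b (reduced b B)) _ d ⟩
  det′ b (reduced b B) *ℤ d *ℤ det′ (suc k) (collapse b k N)
    ≡⟨ cong (_*ℤ det′ (suc k) (collapse b k N)) (det′-reduced-rowSums b B d rowSums) ⟩
  det′ (suc b) B *ℤ det′ (suc k) (collapse b k N)
    ∎
  where
  exchange : ∀ (x y z : ℤ) → x *ℤ y *ℤ z ≡ x *ℤ z *ℤ y
  exchange = solve-∀

  prefixSum : ∀ u v → u < suc b → v ≤ b → ∑ (suc v) (N u) ≡ ∑ (suc v) (B u) +ℤ + suc v *ℤ α
  prefixSum u v u≤b v≤b = ∑-offset (suc v) α (λ t t≤v → offset u t u≤b (s≤s (ℕP.≤-trans (ℕP.≤-pred t≤v) v≤b)))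

  topLeft : ∀ u v → u < b → v < b → reduced b N u v ≡ reduced b B u v
  topLeft u v u<b v<b = begin
    reduced b N u v
      ≡⟨ reduced-<-≤ b N u v u<b (ℕP.<⇒≤ v<b) ⟩
    ∑ (suc v) (N u) +ℤ (- + 1) *ℤ ∑ (suc v) (N (suc u))
      ≡⟨ cong₂ (λ x y → x +ℤ (- + 1) *ℤ y) (prefixSum u v (ℕP.<-trans u<b (ℕP.n<1+n b)) (ℕP.<⇒≤ v<b))
                                          (prefixSum (suc u) v (s≤s u<b) (ℕP.<⇒≤ v<b)) ⟩
    ∑ (suc v) (B u) +ℤ + suc v *ℤ α +ℤ (- + 1) *ℤ (∑ (suc v) (B (suc u)) +ℤ + suc v *ℤ α)
      ≡⟨ cancel (∑ (suc v) (B u)) (∑ (suc v) (B (suc u))) (+ suc v *ℤ α) ⟩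
    ∑ (suc v) (B u) +ℤ (- + 1) *ℤ ∑ (suc v) (B (suc u))
      ≡⟨ sym (reduced-<-≤ b B u v u<b (ℕP.<⇒≤ v<b)) ⟩
    reduced b B u v
      ∎
    where
    cancel : ∀ (P Q q : ℤ) → P +ℤ q +ℤ (- + 1) *ℤ (Q +ℤ q) ≡ P +ℤ (- + 1) *ℤ Q
    cancel = solve-∀

  upperRight≡0 : ∀ u v → u < b → b ≤ v → v < b + suc k → reduced b N u v ≡ + 0
  upperRight≡0 u v u<b b≤v v<n with v ℕP.≟ b
  ... | yes refl = begin
    reduced b N u b
      ≡⟨ reduced-<-≤ b N u b u<b ℕP.≤-refl ⟩
    ∑ (suc b) (N u) +ℤ (- + 1) *ℤ ∑ (suc b) (N (suc u))
      ≡⟨ cong₂ (λ x y → x +ℤ (- + 1) *ℤ y) (rowSum u (ℕP.<-trans u<b (ℕP.n<1+n b))) (rowSum (suc u) (s≤s u<b)) ⟩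
    d +ℤ + suc b *ℤ α +ℤ (- + 1) *ℤ (d +ℤ + suc b *ℤ α)
      ≡⟨ x-x≡0 (d +ℤ + suc b *ℤ α) ⟩
    + 0
      ∎
    where
    rowSum : ∀ u → u < suc b → ∑ (suc b) (N u) ≡ d +ℤ + suc b *ℤ α
    rowSum u u≤b = trans (prefixSum u b u≤b ℕP.≤-refl) (cong (_+ℤ + suc b *ℤ α) (rowSums u u≤b))
  ... | no v≢b = begin
    reduced b N u v
      ≡⟨ reduced-<-> b N u v u<b b<v ⟩
    N u v +ℤ (- + 1) *ℤ N (suc u) v
      ≡⟨ cong (λ y → N u v +ℤ (- + 1) *ℤ y) (sym sameColumn) ⟩
    N u v +ℤ (- + 1) *ℤ N u v
      ≡⟨ x-x≡0 (N u v) ⟩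
    + 0
      ∎
    where
    b<v : b < v
    b<v = ℕP.≤∧≢⇒< b≤v (λ e → v≢b (sym e))
    v≡suc-b+w : v ≡ suc b + (v ℕ.∸ suc b)
    v≡suc-b+w = sym (ℕP.m+[n∸m]≡n b<v)
    w<k : v ℕ.∸ suc b < k
    w<k = ℕP.+-cancelˡ-< (suc b) _ _ (subst (_< suc b + k) v≡suc-b+w (subst (v <_) (ℕP.+-suc b k) v<n))
    sameColumn : N u v ≡ N (suc u) v
    sameColumn = subst (λ v → N u v ≡ N (suc u) v) (sym v≡suc-b+w) (equalRows u (v ℕ.∸ suc b) u<b w<k)

-- Graphs of diameter two

eqb⇒≡ : ∀ {n} (i j : Fin n) → eqb i j ≡ true → i ≡ j
eqb⇒≡ i j h with i F.≟ j
... | yes i≡j = i≡j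
eqb⇒≡ i j () | no _

eqb-refl : ∀ {n} (i : Fin n) → eqb i i ≡ true
eqb-refl i with i F.≟ i
... | yes _  = refl
... | no i≢i = ⊥-elim (i≢i refl)

≢⇒eqb≡false : ∀ {n} (i j : Fin n) → ¬ (i ≡ j) → eqb i j ≡ false
≢⇒eqb≡false i j i≢j with i F.≟ j
... | yes i≡j = ⊥-elim (i≢j i≡j)
... | no _    = refl

eqb-injective : ∀ {n m} (f : Fin n → Fin m) → (∀ {a b} → f a ≡ f b → a ≡ b) → ∀ i j → eqb (f i) (f j) ≡ eqb i j
eqb-injective f f-inj i j with i F.≟ j
... | yes refl = eqb-refl (f i)
... | no i≢j   = ≢⇒eqb≡false (f i) (f j) (λ e → i≢j (f-inj e))

anyFin-false : ∀ n → anyFin n (λ _ → false) ≡ false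
anyFin-false zero    = refl
anyFin-false (suc n) = anyFin-false n

anyFin-witness : ∀ n (f : Fin n → Bool) i → f i ≡ true → anyFin n f ≡ true
anyFin-witness (suc n) f F.zero    h rewrite h = refl
anyFin-witness (suc n) f (F.suc i) h rewrite anyFin-witness n (λ i → f (F.suc i)) i h = BP.∨-zeroʳ (f F.zero)

anyFin-cong : ∀ n {f g : Fin n → Bool} → (∀ i → f i ≡ g i) → anyFin n f ≡ anyFin n g
anyFin-cong zero    h = refl
anyFin-cong (suc n) h = cong₂ _∨_ (h F.zero) (anyFin-cong n (λ i → h (F.suc i)))

anyFin-eqb-∧ : ∀ n (u : Fin n) (g : Fin n → Bool) → anyFin n (λ w → eqb u w ∧ g w) ≡ g u
anyFin-eqb-∧ (suc n) F.zero    g = trans (cong (g F.zero ∨_) (anyFin-false n)) (BP.∨-identityʳ (g F.zero))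
anyFin-eqb-∧ (suc n) (F.suc u) g =
  trans (anyFin-cong n (λ w → cong (_∧ g (F.suc w)) (eqb-injective F.suc FP.suc-injective u w)))
        (anyFin-eqb-∧ n u (λ w → g (F.suc w)))

reach-1 : ∀ {n} (A : AdjRel n) u v → reach A 1 u v ≡ (eqb u v ∨ A u v)
reach-1 {n} A u v = cong (eqb u v ∨_) (anyFin-eqb-∧ n u (λ w → A w v))

reach-2-adjacent : ∀ {n} (A : AdjRel n) u v → A u v ≡ true → reach A 2 u v ≡ true
reach-2-adjacent A u v h rewrite reach-1 A u v | h | BP.∨-zeroʳ (eqb u v) = refl

reach-2-via : ∀ {n} (A : AdjRel n) u w v → A u w ≡ true → A w v ≡ true → reach A 2 u v ≡ true
reach-2-via {n} A u w v uw vw = begin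
  reach A 1 u v ∨ anyFin n (λ w → reach A 1 u w ∧ A w v)   ≡⟨ cong (reach A 1 u v ∨_) (anyFin-witness n _ w viaW) ⟩
  reach A 1 u v ∨ true                                     ≡⟨ BP.∨-zeroʳ (reach A 1 u v) ⟩
  true                                                     ∎
  where
  viaW : (reach A 1 u w ∧ A w v) ≡ true
  viaW rewrite reach-1 A u w | uw | BP.∨-zeroʳ (eqb u w) = vw

-- dist searches lengths 0, 1, …, n − 1, so it sees the value 2 only when n ≥ 3.
dist-diameter₂ : ∀ {n} (A : AdjRel n) u v → 3 ≤ n → reach A 2 u v ≡ true →
  dist A u v ≡ (if eqb u v then 0 else if A u v then 1 else 2)
dist-diameter₂ {suc (suc (suc m))} A u v (s≤s (s≤s (s≤s z≤n))) reach₂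
  rewrite reach₂ | anyFin-eqb-∧ _ u (λ w → A w v) with eqb u v
... | true  = refl
... | false = refl

sumℕ-cong : ∀ n {f g : Fin n → ℕ} → (∀ i → f i ≡ g i) → sumℕ n f ≡ sumℕ n g
sumℕ-cong zero    h = refl
sumℕ-cong (suc n) h = cong₂ _+_ (h F.zero) (sumℕ-cong n (λ i → h (F.suc i)))

sumℕ-+ : ∀ n (f g : Fin n → ℕ) → sumℕ n (λ i → f i + g i) ≡ sumℕ n f + sumℕ n g
sumℕ-+ zero    f g = refl
sumℕ-+ (suc n) f g rewrite sumℕ-+ n (λ i → f (F.suc i)) (λ i → g (F.suc i)) = interchange (f F.zero) (g F.zero) _ _
  where
  interchange : ∀ (a b c d : ℕ) → a + b + (c + d) ≡ a + c + (b + d)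
  interchange = ℕSolver.solve-∀

sumℕ-*ˡ : ∀ n c (f : Fin n → ℕ) → sumℕ n (λ i → c * f i) ≡ c * sumℕ n f
sumℕ-*ˡ zero    c f = sym (ℕP.*-zeroʳ c)
sumℕ-*ˡ (suc n) c f rewrite sumℕ-*ˡ n c (λ i → f (F.suc i)) = sym (ℕP.*-distribˡ-+ c (f F.zero) _)

sumℕ-const : ∀ n c → sumℕ n (λ _ → c) ≡ n * c
sumℕ-const zero    c = refl
sumℕ-const (suc n) c = cong (_+_ c) (sumℕ-const n c)

sumℕ-++ : ∀ m k (f : Fin (m + k) → ℕ) → sumℕ (m + k) f ≡ sumℕ m (λ i → f (i ↑ˡ k)) + sumℕ k (λ j → f (m ↑ʳ j))
sumℕ-++ zero    k f = refl
sumℕ-++ (suc m) k f rewrite sumℕ-++ m k (λ i → f (F.suc i)) = sym (ℕP.+-assoc (f F.zero) _ _)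

sumℕ-eqb : ∀ n (i : Fin n) → sumℕ n (λ j → b2ℕ (eqb i j)) ≡ 1
sumℕ-eqb (suc n) F.zero    = cong suc (trans (sumℕ-const n 0) (ℕP.*-zeroʳ n))
sumℕ-eqb (suc n) (F.suc i) =
  trans (sumℕ-cong n (λ j → cong b2ℕ (eqb-injective F.suc FP.suc-injective i j))) (sumℕ-eqb n i)

-- In a loopless graph of diameter ≤ 2, d(u,v) + [u ~ v] + 2 [u = v] = 2 for all u, v.
transmission+degree : ∀ {n} (A : AdjRel n) → (∀ u → A u u ≡ false) → 3 ≤ n → (∀ u v → reach A 2 u v ≡ true) →
  ∀ u → transmission A u + degree A u + 2 ≡ 2 * n
transmission+degree {n} A loopless 3≤n reach₂ u = begin
  transmission A u + degree A u + 2
    ≡⟨ cong (_+_ (transmission A u + degree A u)) (cong (2 *_) (sym (sumℕ-eqb n u))) ⟩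
  transmission A u + degree A u + 2 * sumℕ n (λ v → b2ℕ (eqb u v))
    ≡⟨ cong₂ _+_ (sym (sumℕ-+ n (dist A u) (λ v → b2ℕ (A u v)))) (sym (sumℕ-*ˡ n 2 (λ v → b2ℕ (eqb u v)))) ⟩
  sumℕ n (λ v → dist A u v + b2ℕ (A u v)) + sumℕ n (λ v → 2 * b2ℕ (eqb u v))
    ≡⟨ sym (sumℕ-+ n _ _) ⟩
  sumℕ n (λ v → dist A u v + b2ℕ (A u v) + 2 * b2ℕ (eqb u v))
    ≡⟨ sumℕ-cong n pointwise ⟩
  sumℕ n (λ _ → 2)
    ≡⟨ trans (sumℕ-const n 2) (ℕP.*-comm n 2) ⟩
  2 * n
    ∎
  where
  pointwise : ∀ v → dist A u v + b2ℕ (A u v) + 2 * b2ℕ (eqb u v) ≡ 2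
  pointwise v rewrite dist-diameter₂ A u v 3≤n (reach₂ u v) with eqb u v in u≟v
  ... | true rewrite eqb⇒≡ u v u≟v | loopless v = refl
  ... | false with A u v
  ...   | true  = refl
  ...   | false = refl

sumℤ-cong : ∀ n {f g : Fin n → ℤ} → (∀ i → f i ≡ g i) → sumℤ n f ≡ sumℤ n g
sumℤ-cong zero    h = refl
sumℤ-cong (suc n) h = cong₂ _+ℤ_ (h F.zero) (sumℤ-cong n (λ i → h (F.suc i)))

sumℤ-pos : ∀ n (f : Fin n → ℕ) → sumℤ n (λ i → + f i) ≡ + sumℕ n f
sumℤ-pos zero    f = refl
sumℤ-pos (suc n) f rewrite sumℤ-pos n (λ i → f (F.suc i)) = sym (ℤP.pos-+ (f F.zero) _)

sumℤ-sub : ∀ n (f g : Fin n → ℤ) → sumℤ n (λ i → f i - g i) ≡ sumℤ n f - sumℤ n g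
sumℤ-sub zero    f g = refl
sumℤ-sub (suc n) f g rewrite sumℤ-sub n (λ i → f (F.suc i)) (λ i → g (F.suc i)) = interchange (f F.zero) (g F.zero) _ _
  where
  interchange : ∀ (a b c d : ℤ) → a - b +ℤ (c - d) ≡ a +ℤ c - (b +ℤ d)
  interchange = solve-∀

sumℤ-eqb : ∀ n (i : Fin n) (y : ℤ) → sumℤ n (λ j → if eqb i j then y else + 0) ≡ y
sumℤ-eqb (suc n) F.zero    y = trans (cong (y +ℤ_) (zeros n)) (ℤP.+-identityʳ y)
  where
  zeros : ∀ n → sumℤ n (λ _ → + 0) ≡ + 0
  zeros zero    = refl
  zeros (suc n) = trans (ℤP.+-identityˡ _) (zeros n)
sumℤ-eqb (suc n) (F.suc i) y = trans (ℤP.+-identityˡ _) (trans (sumℤ-cong n λ j →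
  cong (λ b → if b then y else + 0) (eqb-injective F.suc FP.suc-injective i j)) (sumℤ-eqb n i y))

charMatrix : ∀ {n} → Matrix n → ℤ → Matrix n
charMatrix M x u v = (if eqb u v then x else + 0) - M u v

charMatrix-adj-rowSum : ∀ {n} (A : AdjRel n) (y : ℤ) r → IsRegular A r →
  ∀ i → sumℤ n (charMatrix (adjMatrix A) y i) ≡ y - + r
charMatrix-adj-rowSum {n} A y r regular i = begin
  sumℤ n (charMatrix (adjMatrix A) y i)
    ≡⟨ sumℤ-sub n (λ j → if eqb i j then y else + 0) (adjMatrix A i) ⟩
  sumℤ n (λ j → if eqb i j then y else + 0) - sumℤ n (adjMatrix A i)
    ≡⟨ cong₂ _-_ (sumℤ-eqb n i y) (sumℤ-pos n (λ j → b2ℕ (A i j))) ⟩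
  y - + degree A i
    ≡⟨ cong (λ r → y - + r) (regular i) ⟩
  y - + r
    ∎

toMat : ∀ {m} → Matrix m → Mat
toMat {m} M a b with a ℕP.<? m | b ℕP.<? m
... | yes p | yes q = M (fromℕ< p) (fromℕ< q)
... | _     | _     = + 0

toMat-toℕ : ∀ {m} (M : Matrix m) (i j : Fin m) → toMat M (toℕ i) (toℕ j) ≡ M i j
toMat-toℕ {m} M i j with toℕ i ℕP.<? m | toℕ j ℕP.<? m
... | yes p | yes q = cong₂ M (FP.fromℕ<-toℕ i p) (FP.fromℕ<-toℕ j q)
... | no ¬p | _     = ⊥-elim (¬p (FP.toℕ<n i))
... | yes _ | no ¬q = ⊥-elim (¬q (FP.toℕ<n j))

det≡det′-toMat : ∀ n (M : Matrix n) → det n M ≡ det′ n (toMat M)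
det≡det′-toMat n M = det≡det′ n M (toMat M) (λ i j → sym (toMat-toℕ M i j))

toMat-embed : ∀ {m a c} (M : Matrix m) (e : Fin a → Fin m) (f : Fin c → Fin m) {g h : ℕ → ℕ} →
  (∀ i → toℕ (e i) ≡ g (toℕ i)) → (∀ j → toℕ (f j) ≡ h (toℕ j)) →
  ∀ {u v} (p : u < a) (q : v < c) → toMat M (g u) (h v) ≡ M (e (fromℕ< p)) (f (fromℕ< q))
toMat-embed M e f {g} {h} e-pos f-pos {u} {v} p q = begin
  toMat M (g u) (h v)
    ≡⟨ sym (cong₂ (toMat M) (trans (e-pos _) (cong g (FP.toℕ-fromℕ< p))) (trans (f-pos _) (cong h (FP.toℕ-fromℕ< q)))) ⟩
  toMat M (toℕ (e (fromℕ< p))) (toℕ (f (fromℕ< q)))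
    ≡⟨ toMat-toℕ M _ _ ⟩
  M (e (fromℕ< p)) (f (fromℕ< q))
    ∎

toMat-fromℕ< : ∀ {m} (M : Matrix m) {u v} (p : u < m) (q : v < m) → toMat M u v ≡ M (fromℕ< p) (fromℕ< q)
toMat-fromℕ< M = toMat-embed M (λ i → i) (λ j → j) (λ _ → refl) (λ _ → refl)

∑-toMat-row : ∀ {m} (M : Matrix m) {u} (p : u < m) → ∑ m (toMat M u) ≡ sumℤ m (M (fromℕ< p))
∑-toMat-row {m} M {u} p = sym (sumℤ≡∑ m (M (fromℕ< p)) (toMat M u) entry)
  where
  entry : ∀ j → M (fromℕ< p) j ≡ toMat M u (toℕ j)
  entry j = sym (trans (toMat-fromℕ< M p (FP.toℕ<n j)) (cong (M (fromℕ< p)) (FP.fromℕ<-toℕ j (FP.toℕ<n j))))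

toMat-charMatrix-adj-rowSum : ∀ {m} (A : AdjRel m) r (d : ℤ) → IsRegular A r →
  ∀ {u} (p : u < m) → ∑ m (toMat (charMatrix (adjMatrix A) (d +ℤ + r)) u) ≡ d
toMat-charMatrix-adj-rowSum A r d regular p = trans (∑-toMat-row _ p)
  (trans (charMatrix-adj-rowSum A (d +ℤ + r) r regular (fromℕ< p)) (cancel d (+ r)))
  where
  cancel : ∀ (d r : ℤ) → d +ℤ r - r ≡ d
  cancel = solve-∀

-- Joins and disjoint unions

↑ˡ≢↑ʳ : ∀ {n m} (i : Fin n) (j : Fin m) → ¬ (i ↑ˡ m ≡ n ↑ʳ j)
↑ˡ≢↑ʳ {n} {m} i j eq with trans (sym (FP.splitAt-↑ˡ n i m)) (trans (cong (splitAt n) eq) (FP.splitAt-↑ʳ n m j))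
... | ()

data Side (n : ℕ) {m : ℕ} : Fin (n + m) → Set where
  left  : (i : Fin n) → Side n (i ↑ˡ m)
  right : (j : Fin m) → Side n (n ↑ʳ j)

side : ∀ n {m} (u : Fin (n + m)) → Side n u
side n {m} u with splitAt n u in eq
... | inj₁ i = subst (Side n) (FP.splitAt⁻¹-↑ˡ eq) (left i)
... | inj₂ j = subst (Side n) (FP.splitAt⁻¹-↑ʳ eq) (right j)

sumℕ-b2ℕ-true : ∀ l (f : Fin l → Bool) → (∀ i → f i ≡ true) → sumℕ l (λ i → b2ℕ (f i)) ≡ l
sumℕ-b2ℕ-true l f h = trans (sumℕ-cong l (λ i → cong b2ℕ (h i))) (trans (sumℕ-const l 1) (ℕP.*-identityʳ l))

sumℕ-b2ℕ-false : ∀ l (f : Fin l → Bool) → (∀ i → f i ≡ false) → sumℕ l (λ i → b2ℕ (f i)) ≡ 0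
sumℕ-b2ℕ-false l f h = trans (sumℕ-cong l (λ i → cong b2ℕ (h i))) (trans (sumℕ-const l 0) (ℕP.*-zeroʳ l))

module _ {n m : ℕ} (A : AdjRel n) (B : AdjRel m) where

  join-↑ˡ-↑ˡ : ∀ i j → join A B (i ↑ˡ m) (j ↑ˡ m) ≡ A i j
  join-↑ˡ-↑ˡ i j rewrite FP.splitAt-↑ˡ n i m | FP.splitAt-↑ˡ n j m = refl

  join-↑ˡ-↑ʳ : ∀ i j → join A B (i ↑ˡ m) (n ↑ʳ j) ≡ true
  join-↑ˡ-↑ʳ i j rewrite FP.splitAt-↑ˡ n i m | FP.splitAt-↑ʳ n m j = refl

  join-↑ʳ-↑ˡ : ∀ i j → join A B (n ↑ʳ i) (j ↑ˡ m) ≡ true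
  join-↑ʳ-↑ˡ i j rewrite FP.splitAt-↑ʳ n m i | FP.splitAt-↑ˡ n j m = refl

  join-↑ʳ-↑ʳ : ∀ i j → join A B (n ↑ʳ i) (n ↑ʳ j) ≡ B i j
  join-↑ʳ-↑ʳ i j rewrite FP.splitAt-↑ʳ n m i | FP.splitAt-↑ʳ n m j = refl

  union-↑ˡ-↑ˡ : ∀ i j → union A B (i ↑ˡ m) (j ↑ˡ m) ≡ A i j
  union-↑ˡ-↑ˡ i j rewrite FP.splitAt-↑ˡ n i m | FP.splitAt-↑ˡ n j m = refl

  union-↑ˡ-↑ʳ : ∀ i j → union A B (i ↑ˡ m) (n ↑ʳ j) ≡ false
  union-↑ˡ-↑ʳ i j rewrite FP.splitAt-↑ˡ n i m | FP.splitAt-↑ʳ n m j = refl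

  union-↑ʳ-↑ˡ : ∀ i j → union A B (n ↑ʳ i) (j ↑ˡ m) ≡ false
  union-↑ʳ-↑ˡ i j rewrite FP.splitAt-↑ʳ n m i | FP.splitAt-↑ˡ n j m = refl

  union-↑ʳ-↑ʳ : ∀ i j → union A B (n ↑ʳ i) (n ↑ʳ j) ≡ B i j
  union-↑ʳ-↑ʳ i j rewrite FP.splitAt-↑ʳ n m i | FP.splitAt-↑ʳ n m j = refl

  module _ (A-loopless : ∀ i → A i i ≡ false) (B-loopless : ∀ j → B j j ≡ false) where

    join-loopless : ∀ u → join A B u u ≡ false
    join-loopless u with side n u
    ... | left i  = trans (join-↑ˡ-↑ˡ i i) (A-loopless i)
    ... | right j = trans (join-↑ʳ-↑ʳ j j) (B-loopless j)

    union-loopless : ∀ u → union A B u u ≡ false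
    union-loopless u with side n u
    ... | left i  = trans (union-↑ˡ-↑ˡ i i) (A-loopless i)
    ... | right j = trans (union-↑ʳ-↑ʳ j j) (B-loopless j)

  degree-join-↑ˡ : ∀ i → degree (join A B) (i ↑ˡ m) ≡ degree A i + m
  degree-join-↑ˡ i = trans (sumℕ-++ n m _)
    (cong₂ _+_ (sumℕ-cong n (λ j → cong b2ℕ (join-↑ˡ-↑ˡ i j))) (sumℕ-b2ℕ-true m _ (join-↑ˡ-↑ʳ i)))

  degree-join-↑ʳ : ∀ j → degree (join A B) (n ↑ʳ j) ≡ n + degree B j
  degree-join-↑ʳ j = trans (sumℕ-++ n m _)
    (cong₂ _+_ (sumℕ-b2ℕ-true n _ (join-↑ʳ-↑ˡ j)) (sumℕ-cong m (λ l → cong b2ℕ (join-↑ʳ-↑ʳ j l))))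

  degree-union-↑ˡ : ∀ i → degree (union A B) (i ↑ˡ m) ≡ degree A i
  degree-union-↑ˡ i = trans (sumℕ-++ n m _) (trans
    (cong₂ _+_ (sumℕ-cong n (λ j → cong b2ℕ (union-↑ˡ-↑ˡ i j))) (sumℕ-b2ℕ-false m _ (union-↑ˡ-↑ʳ i)))
    (ℕP.+-identityʳ _))

  degree-union-↑ʳ : ∀ j → degree (union A B) (n ↑ʳ j) ≡ degree B j
  degree-union-↑ʳ j = trans (sumℕ-++ n m _)
    (cong₂ _+_ (sumℕ-b2ℕ-false n _ (union-↑ʳ-↑ˡ j)) (sumℕ-cong m (λ l → cong b2ℕ (union-↑ʳ-↑ʳ j l))))

join-reach₂ : ∀ {n m} (A : AdjRel (suc n)) (B : AdjRel (suc m)) u v → reach (join A B) 2 u v ≡ true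
join-reach₂ {n} {m} A B u v with side (suc n) u | side (suc n) v
... | left i  | left j  = reach-2-via (join A B) (i ↑ˡ suc m) (suc n ↑ʳ F.zero) (j ↑ˡ suc m) (join-↑ˡ-↑ʳ A B i F.zero) (join-↑ʳ-↑ˡ A B F.zero j)
... | left i  | right j = reach-2-adjacent (join A B) (i ↑ˡ suc m) (suc n ↑ʳ j) (join-↑ˡ-↑ʳ A B i j)
... | right i | left j  = reach-2-adjacent (join A B) (suc n ↑ʳ i) (j ↑ˡ suc m) (join-↑ʳ-↑ˡ A B i j)
... | right i | right j = reach-2-via (join A B) (suc n ↑ʳ i) (F.zero ↑ˡ suc m) (suc n ↑ʳ j) (join-↑ʳ-↑ˡ A B i F.zero) (join-↑ˡ-↑ʳ A B F.zero j)

charMatrix-distLaplacian : ∀ {n} (A : AdjRel n) (x : ℤ) → 3 ≤ n → (∀ u v → reach A 2 u v ≡ true) → ∀ u v →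
  charMatrix (distLaplacian A) x u v ≡ (if eqb u v then x - + transmission A u else + (if A u v then 1 else 2))
charMatrix-distLaplacian A x 3≤n reach₂ u v rewrite dist-diameter₂ A u v 3≤n (reach₂ u v) with eqb u v
... | true  = cong (_-_ x) (ℤP.+-identityʳ (+ transmission A u))
... | false with A u v
...   | true  = refl
...   | false = refl

-- The join G₁ ∇ (G₂ ∪ G₃)

module JoinOfUnion {a₁ a₂ a₃ r₁ r₂ r₃ : ℕ} (G₁ : AdjRel (suc a₁)) (G₂ : AdjRel (suc a₂)) (G₃ : AdjRel (suc a₃))
  (S₁ : IsSimple G₁) (S₂ : IsSimple G₂) (S₃ : IsSimple G₃)
  (R₁ : IsRegular G₁ r₁) (R₂ : IsRegular G₂ r₂) (R₃ : IsRegular G₃ r₃) where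

  n₁ n₂ n₃ k N : ℕ
  n₁ = suc a₁
  n₂ = suc a₂
  n₃ = suc a₃
  k  = n₂ + n₃
  N  = n₁ + k

  H : AdjRel k
  H = union G₂ G₃

  G : AdjRel N
  G = join G₁ H

  ι₁ : Fin n₁ → Fin N
  ι₁ i = i ↑ˡ k

  ιₕ : Fin k → Fin N
  ιₕ j = n₁ ↑ʳ j

  ι₂ : Fin n₂ → Fin N
  ι₂ i = ιₕ (i ↑ˡ n₃)

  ι₃ : Fin n₃ → Fin N
  ι₃ i = ιₕ (n₂ ↑ʳ i)

  G-loopless : ∀ u → G u u ≡ false
  G-loopless = join-loopless G₁ H (IsSimple.irreflexive S₁)
                 (union-loopless G₂ G₃ (IsSimple.irreflexive S₂) (IsSimple.irreflexive S₃))

  3≤N : 3 ≤ N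
  3≤N = ℕP.+-mono-≤ (s≤s z≤n) (ℕP.+-mono-≤ (s≤s z≤n) (s≤s z≤n))

  G-reach₂ : ∀ u v → reach G 2 u v ≡ true
  G-reach₂ = join-reach₂ G₁ H

  P₁ P₂ : ℕ
  P₁ = 2 * n₁ + n₂ + n₃
  P₂ = n₁ + 2 * n₂ + 2 * n₃

  transmission-from-degree : ∀ u r c P → degree G u ≡ r + c → c + P ≡ 2 * N → transmission G u + r + 2 ≡ P
  transmission-from-degree u r c P deg≡ P≡ = ℕP.+-cancelˡ-≡ c _ _ (begin
    c + (transmission G u + r + 2)     ≡⟨ reorder c (transmission G u) r ⟩
    transmission G u + (r + c) + 2     ≡⟨ cong (λ d → transmission G u + d + 2) (sym deg≡) ⟩
    transmission G u + degree G u + 2  ≡⟨ transmission+degree G G-loopless 3≤N G-reach₂ u ⟩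
    2 * N                              ≡⟨ sym P≡ ⟩
    c + P                              ∎)
    where
    reorder : ∀ c t r → c + (t + r + 2) ≡ t + (r + c) + 2
    reorder = ℕSolver.solve-∀

  transmission-ι₁ : ∀ i → transmission G (ι₁ i) + r₁ + 2 ≡ P₁
  transmission-ι₁ i = transmission-from-degree (ι₁ i) r₁ k P₁
    (trans (degree-join-↑ˡ G₁ H i) (cong (_+ k) (R₁ i))) (total a₁ a₂ a₃)
    where
    total : ∀ a b c → suc b + suc c + (2 * suc a + suc b + suc c) ≡ 2 * (suc a + (suc b + suc c))
    total = ℕSolver.solve-∀

  transmission-ιₕ : ∀ j r → degree H j ≡ r → transmission G (ιₕ j) + r + 2 ≡ P₂
  transmission-ιₕ j r deg≡ = transmission-from-degree (ιₕ j) r n₁ P₂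
    (trans (degree-join-↑ʳ G₁ H j) (trans (cong (_+_ n₁) deg≡) (ℕP.+-comm n₁ r))) (total a₁ a₂ a₃)
    where
    total : ∀ a b c → suc a + (suc a + 2 * suc b + 2 * suc c) ≡ 2 * (suc a + (suc b + suc c))
    total = ℕSolver.solve-∀

  transmission-ι₂ : ∀ i → transmission G (ι₂ i) + r₂ + 2 ≡ P₂
  transmission-ι₂ i = transmission-ιₕ (i ↑ˡ n₃) r₂ (trans (degree-union-↑ˡ G₂ G₃ i) (R₂ i))

  transmission-ι₃ : ∀ i → transmission G (ι₃ i) + r₃ + 2 ≡ P₂
  transmission-ι₃ i = transmission-ιₕ (n₂ ↑ʳ i) r₃ (trans (degree-union-↑ʳ G₂ G₃ i) (R₃ i))

  module _ (x : ℤ) where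

    Φ : Matrix N
    Φ = charMatrix (distLaplacian G) x

    d₁ d₂ : ℤ
    d₁ = x - + P₁
    d₂ = x - + P₂

    C₁ : Matrix n₁
    C₁ = charMatrix (adjMatrix G₁) (d₁ +ℤ + r₁)

    C₂ : Matrix n₂
    C₂ = charMatrix (adjMatrix G₂) (d₂ +ℤ + r₂)

    C₃ : Matrix n₃
    C₃ = charMatrix (adjMatrix G₃) (d₂ +ℤ + r₃)

    Φ-offDiagonal : ∀ u v → ¬ u ≡ v → Φ u v ≡ + (if G u v then 1 else 2)
    Φ-offDiagonal u v u≢v = trans (charMatrix-distLaplacian G x 3≤N G-reach₂ u v)
      (cong (λ b → if b then x - + transmission G u else + (if G u v then 1 else 2)) (≢⇒eqb≡false u v u≢v))

    Ψ : Mat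
    Ψ = toMat Φ

    module _ {m} (B : AdjRel m) (e : Fin m → Fin N) (e-injective : ∀ {i j} → e i ≡ e j → i ≡ j)
      (e-adj : ∀ i j → G (e i) (e j) ≡ B i j) (B-loopless : ∀ i → B i i ≡ false)
      (r P : ℕ) (e-transmission : ∀ i → transmission G (e i) + r + 2 ≡ P) where

      private
        y : ℤ
        y = x - + P +ℤ + r

        diagonalEntry : ∀ i → Φ (e i) (e i) ≡ charMatrix (adjMatrix B) y i i +ℤ + 2
        diagonalEntry i = begin
          Φ (e i) (e i)
            ≡⟨ charMatrix-distLaplacian G x 3≤N G-reach₂ (e i) (e i) ⟩
          (if eqb (e i) (e i) then x - + T else + (if G (e i) (e i) then 1 else 2))
            ≡⟨ cong (λ b → if b then x - + T else + (if G (e i) (e i) then 1 else 2)) (eqb-refl (e i)) ⟩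
          x - + T
            ≡⟨ shift T (e-transmission i) ⟩
          y - + 0 +ℤ + 2
            ≡⟨ sym (cong₂ (λ b c → (if b then y else + 0) - + b2ℕ c +ℤ + 2) (eqb-refl i) (B-loopless i)) ⟩
          charMatrix (adjMatrix B) y i i +ℤ + 2
            ∎
          where
          T = transmission G (e i)
          shift : ∀ T → T + r + 2 ≡ P → x - + T ≡ y - + 0 +ℤ + 2
          shift T refl rewrite ℤP.pos-+ (T + r) 2 | ℤP.pos-+ T r = polynomial x (+ T) (+ r)
            where
            polynomial : ∀ (x t r : ℤ) → x - t ≡ x - (t +ℤ r +ℤ + 2) +ℤ r - + 0 +ℤ + 2
            polynomial = solve-∀

        offDiagonalEntry : ∀ i j → ¬ i ≡ j → Φ (e i) (e j) ≡ charMatrix (adjMatrix B) y i j +ℤ + 2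
        offDiagonalEntry i j i≢j = begin
          Φ (e i) (e j)                      ≡⟨ Φ-offDiagonal (e i) (e j) (λ eq → i≢j (e-injective eq)) ⟩
          + (if G (e i) (e j) then 1 else 2) ≡⟨ cong (λ b → + (if b then 1 else 2)) (e-adj i j) ⟩
          + (if B i j then 1 else 2)         ≡⟨ value (B i j) ⟩
          + 0 - + b2ℕ (B i j) +ℤ + 2         ≡⟨ sym (cong (λ b → (if b then y else + 0) - + b2ℕ (B i j) +ℤ + 2) (≢⇒eqb≡false i j i≢j)) ⟩
          charMatrix (adjMatrix B) y i j +ℤ + 2 ∎
          where
          value : ∀ b → + (if b then 1 else 2) ≡ + 0 - + b2ℕ b +ℤ + 2
          value true  = refl
          value false = refl

      Φ-diagonalBlock : ∀ i j → Φ (e i) (e j) ≡ charMatrix (adjMatrix B) y i j +ℤ + 2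
      Φ-diagonalBlock i j with toℕ i ℕP.≟ toℕ j
      ... | yes i≡j = subst (λ j → Φ (e i) (e j) ≡ charMatrix (adjMatrix B) y i j +ℤ + 2) (FP.toℕ-injective i≡j) (diagonalEntry i)
      ... | no i≢j  = offDiagonalEntry i j (λ eq → i≢j (cong toℕ eq))

      Ψ-diagonalBlock : ∀ {g : ℕ → ℕ} → (∀ i → toℕ (e i) ≡ g (toℕ i)) →
        ∀ {u v} (p : u < m) (q : v < m) → Ψ (g u) (g v) ≡ toMat (charMatrix (adjMatrix B) y) u v +ℤ + 2
      Ψ-diagonalBlock {g} e-pos {u} {v} p q = begin
        Ψ (g u) (g v)              ≡⟨ toMat-embed Φ e e {g} {g} e-pos e-pos p q ⟩
        Φ (e i) (e j)              ≡⟨ Φ-diagonalBlock i j ⟩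
        C i j +ℤ + 2               ≡⟨ cong (_+ℤ + 2) (sym (toMat-fromℕ< C p q)) ⟩
        toMat C u v +ℤ + 2         ∎
        where
        C = charMatrix (adjMatrix B) y
        i = fromℕ< p
        j = fromℕ< q

    Ψ-offBlock : ∀ {a c} (e : Fin a → Fin N) (f : Fin c → Fin N) {g h : ℕ → ℕ} →
      (∀ i → toℕ (e i) ≡ g (toℕ i)) → (∀ j → toℕ (f j) ≡ h (toℕ j)) → (∀ i j → ¬ e i ≡ f j) →
      ∀ b → (∀ i j → G (e i) (f j) ≡ b) → ∀ {u v} (p : u < a) (q : v < c) → Ψ (g u) (h v) ≡ + (if b then 1 else 2)
    Ψ-offBlock e f {g} {h} e-pos f-pos e≢f b adj {u} {v} p q = begin
      Ψ (g u) (h v)                      ≡⟨ toMat-embed Φ e f {g} {h} e-pos f-pos p q ⟩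
      Φ (e i) (f j)                      ≡⟨ Φ-offDiagonal (e i) (f j) (e≢f i j) ⟩
      + (if G (e i) (f j) then 1 else 2) ≡⟨ cong (λ b → + (if b then 1 else 2)) (adj i j) ⟩
      + (if b then 1 else 2)             ∎
      where
      i = fromℕ< p
      j = fromℕ< q

    pos₁ : ∀ i → toℕ (ι₁ i) ≡ toℕ i
    pos₁ i = FP.toℕ-↑ˡ i k

    posₕ : ∀ j → toℕ (ιₕ j) ≡ n₁ + toℕ j
    posₕ j = FP.toℕ-↑ʳ n₁ j

    pos₂ : ∀ i → toℕ (ι₂ i) ≡ n₁ + toℕ i
    pos₂ i = trans (posₕ _) (cong (_+_ n₁) (FP.toℕ-↑ˡ i n₃))

    pos₃ : ∀ i → toℕ (ι₃ i) ≡ n₁ + (n₂ + toℕ i)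
    pos₃ i = trans (posₕ _) (cong (_+_ n₁) (FP.toℕ-↑ʳ n₂ i))

    C₁′ C₂′ C₃′ : Mat
    C₁′ = toMat C₁
    C₂′ = toMat C₂
    C₃′ = toMat C₃

    Ψ₁₁ : ∀ {u v} → u < n₁ → v < n₁ → Ψ u v ≡ C₁′ u v +ℤ + 2
    Ψ₁₁ = Ψ-diagonalBlock G₁ ι₁ (FP.↑ˡ-injective k _ _) (join-↑ˡ-↑ˡ G₁ H) (IsSimple.irreflexive S₁)
            r₁ P₁ transmission-ι₁ {λ u → u} pos₁

    Ψ₂₂ : ∀ {u v} → u < n₂ → v < n₂ → Ψ (n₁ + u) (n₁ + v) ≡ C₂′ u v +ℤ + 2
    Ψ₂₂ = Ψ-diagonalBlock G₂ ι₂ (λ eq → FP.↑ˡ-injective n₃ _ _ (FP.↑ʳ-injective n₁ _ _ eq))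
            (λ i j → trans (join-↑ʳ-↑ʳ G₁ H _ _) (union-↑ˡ-↑ˡ G₂ G₃ i j)) (IsSimple.irreflexive S₂)
            r₂ P₂ transmission-ι₂ {_+_ n₁} pos₂

    Ψ₃₃ : ∀ {u v} → u < n₃ → v < n₃ → Ψ (n₁ + (n₂ + u)) (n₁ + (n₂ + v)) ≡ C₃′ u v +ℤ + 2
    Ψ₃₃ = Ψ-diagonalBlock G₃ ι₃ (λ eq → FP.↑ʳ-injective n₂ _ _ (FP.↑ʳ-injective n₁ _ _ eq))
            (λ i j → trans (join-↑ʳ-↑ʳ G₁ H _ _) (union-↑ʳ-↑ʳ G₂ G₃ i j)) (IsSimple.irreflexive S₃)
            r₃ P₂ transmission-ι₃ {λ w → n₁ + (n₂ + w)} pos₃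

    Ψ₁ₕ : ∀ {u w} → u < n₁ → w < k → Ψ u (n₁ + w) ≡ + 1
    Ψ₁ₕ = Ψ-offBlock ι₁ ιₕ {λ u → u} {_+_ n₁} pos₁ posₕ ↑ˡ≢↑ʳ true (join-↑ˡ-↑ʳ G₁ H)

    Ψₕ₁ : ∀ {w v} → w < k → v < n₁ → Ψ (n₁ + w) v ≡ + 1
    Ψₕ₁ = Ψ-offBlock ιₕ ι₁ {_+_ n₁} {λ u → u} posₕ pos₁ (λ j i eq → ↑ˡ≢↑ʳ i j (sym eq)) true (join-↑ʳ-↑ˡ G₁ H)

    Ψ₂₃ : ∀ {u w} → u < n₂ → w < n₃ → Ψ (n₁ + u) (n₁ + (n₂ + w)) ≡ + 2
    Ψ₂₃ = Ψ-offBlock ι₂ ι₃ {_+_ n₁} {λ w → n₁ + (n₂ + w)} pos₂ pos₃ (λ i j eq → ↑ˡ≢↑ʳ i j (FP.↑ʳ-injective n₁ (i ↑ˡ n₃) (n₂ ↑ʳ j) eq)) false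
            (λ i j → trans (join-↑ʳ-↑ʳ G₁ H _ _) (union-↑ˡ-↑ʳ G₂ G₃ i j))

    Ψ₃₂ : ∀ {w v} → w < n₃ → v < n₂ → Ψ (n₁ + (n₂ + w)) (n₁ + v) ≡ + 2
    Ψ₃₂ = Ψ-offBlock ι₃ ι₂ {λ w → n₁ + (n₂ + w)} {_+_ n₁} pos₃ pos₂ (λ j i eq → ↑ˡ≢↑ʳ i j (sym (FP.↑ʳ-injective n₁ (n₂ ↑ʳ j) (i ↑ˡ n₃) eq))) false
            (λ j i → trans (join-↑ʳ-↑ʳ G₁ H _ _) (union-↑ʳ-↑ˡ G₂ G₃ j i))

    <n₂⇒<k : ∀ {u} → u < n₂ → u < k
    <n₂⇒<k p = ℕP.<-≤-trans p (ℕP.m≤m+n n₂ n₃)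

    <n₃⇒n₂+<k : ∀ {u} → u < n₃ → n₂ + u < k
    <n₃⇒n₂+<k = ℕP.+-monoʳ-< n₂

    C₁-rowSum : ∀ {u} → u < n₁ → ∑ n₁ (C₁′ u) ≡ d₁
    C₁-rowSum = toMat-charMatrix-adj-rowSum G₁ r₁ d₁ R₁

    C₂-rowSum : ∀ {u} → u < n₂ → ∑ n₂ (C₂′ u) ≡ d₂
    C₂-rowSum = toMat-charMatrix-adj-rowSum G₂ r₂ d₂ R₂

    C₃-rowSum : ∀ {u} → u < n₃ → ∑ n₃ (C₃′ u) ≡ d₂
    C₃-rowSum = toMat-charMatrix-adj-rowSum G₃ r₃ d₂ R₃

    -- indices 0 … k − 1 of O₁ are the vertices of G₂ ∪ G₃, index k is the collapsed G₁
    O₁ : Mat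
    O₁ = collapse a₁ k Ψ

    collapse₁ : det′ N Ψ *ℤ d₁ ≡ det′ n₁ C₁′ *ℤ det′ (suc k) O₁
    collapse₁ = det′-collapse a₁ k Ψ C₁′ (+ 2) d₁
      (λ u w u<a₁ w<k → trans (Ψ₁ₕ (ℕP.m<n⇒m<1+n u<a₁) w<k) (sym (Ψ₁ₕ (s≤s u<a₁) w<k)))
      (λ u v → Ψ₁₁) (λ u → C₁-rowSum)

    O₁-HH : ∀ {u v} → u < k → v < k → O₁ u v ≡ Ψ (n₁ + u) (n₁ + v)
    O₁-HH p q = collapse-inner a₁ k Ψ _ _ p q

    O₁-H1 : ∀ {u} → u < k → O₁ u k ≡ + n₁ *ℤ + 1
    O₁-H1 p = trans (collapse-inner-last a₁ k Ψ _ p) (∑-constant n₁ (+ 1) (λ t q → Ψₕ₁ p q))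

    O₁-1H : ∀ {v} → v < k → O₁ k v ≡ + 1
    O₁-1H q = trans (collapse-last-inner a₁ k Ψ _ q) (Ψ₁ₕ (ℕP.n<1+n a₁) q)

    O₁-11 : O₁ k k ≡ d₁ +ℤ + n₁ *ℤ + 2
    O₁-11 = trans (collapse-last-last a₁ k Ψ)
      (trans (∑-offset n₁ (+ 2) (λ t q → Ψ₁₁ (ℕP.n<1+n a₁) q)) (cong (_+ℤ + n₁ *ℤ + 2) (C₁-rowSum (ℕP.n<1+n a₁))))

    -- indices 0 … n₃ − 1 of O₂ are the vertices of G₃, then come the collapsed G₁ and G₂
    O₂ : Mat
    O₂ = collapse a₂ (suc n₃) O₁

    collapse₂ : det′ (suc k) O₁ *ℤ d₂ ≡ det′ n₂ C₂′ *ℤ det′ (2 + n₃) O₂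
    collapse₂ = trans (cong (λ m → det′ (suc m) O₁ *ℤ d₂) (sym (ℕP.+-suc a₂ n₃)))
      (det′-collapse a₂ (suc n₃) O₁ C₂′ (+ 2) d₂ equalRows
        (λ u v p q → trans (O₁-HH (<n₂⇒<k p) (<n₂⇒<k q)) (Ψ₂₂ p q)) (λ u → C₂-rowSum))
      where
      equalRows : ∀ u w → u < a₂ → w < suc n₃ → O₁ u (n₂ + w) ≡ O₁ (suc u) (n₂ + w)
      equalRows u w u<a₂ (s≤s w≤n₃) with ℕP.m≤n⇒m<n∨m≡n w≤n₃
      ... | inj₁ w<n₃ = trans (toG₃ (ℕP.m<n⇒m<1+n u<a₂)) (sym (toG₃ (s≤s u<a₂)))
        where
        toG₃ : ∀ {u} → u < n₂ → O₁ u (n₂ + w) ≡ + 2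
        toG₃ p = trans (O₁-HH (<n₂⇒<k p) (<n₃⇒n₂+<k w<n₃)) (Ψ₂₃ p w<n₃)
      ... | inj₂ refl = trans (O₁-H1 (<n₂⇒<k (ℕP.m<n⇒m<1+n u<a₂))) (sym (O₁-H1 (<n₂⇒<k (s≤s u<a₂))))

    O₂-33 : ∀ {u v} → u < n₃ → v < n₃ → O₂ u v ≡ C₃′ u v +ℤ + 2
    O₂-33 p q = trans (collapse-inner a₂ (suc n₃) O₁ _ _ (ℕP.m<n⇒m<1+n p) (ℕP.m<n⇒m<1+n q))
                      (trans (O₁-HH (<n₃⇒n₂+<k p) (<n₃⇒n₂+<k q)) (Ψ₃₃ p q))

    O₂-31 : ∀ {u} → u < n₃ → O₂ u n₃ ≡ + n₁ *ℤ + 1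
    O₂-31 p = trans (collapse-inner a₂ (suc n₃) O₁ _ n₃ (ℕP.m<n⇒m<1+n p) (ℕP.n<1+n n₃)) (O₁-H1 (<n₃⇒n₂+<k p))

    O₂-32 : ∀ {u} → u < n₃ → O₂ u (suc n₃) ≡ + n₂ *ℤ + 2
    O₂-32 p = trans (collapse-inner-last a₂ (suc n₃) O₁ _ (ℕP.m<n⇒m<1+n p))
      (∑-constant n₂ (+ 2) (λ t q → trans (O₁-HH (<n₃⇒n₂+<k p) (<n₂⇒<k q)) (Ψ₃₂ p q)))

    O₂-13 : ∀ {v} → v < n₃ → O₂ n₃ v ≡ + 1
    O₂-13 q = trans (collapse-inner a₂ (suc n₃) O₁ n₃ _ (ℕP.n<1+n n₃) (ℕP.m<n⇒m<1+n q)) (O₁-1H (<n₃⇒n₂+<k q))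

    O₂-11 : O₂ n₃ n₃ ≡ d₁ +ℤ + n₁ *ℤ + 2
    O₂-11 = trans (collapse-inner a₂ (suc n₃) O₁ n₃ n₃ (ℕP.n<1+n n₃) (ℕP.n<1+n n₃)) O₁-11

    O₂-12 : O₂ n₃ (suc n₃) ≡ + n₂ *ℤ + 1
    O₂-12 = trans (collapse-inner-last a₂ (suc n₃) O₁ n₃ (ℕP.n<1+n n₃)) (∑-constant n₂ (+ 1) (λ t q → O₁-1H (<n₂⇒<k q)))

    O₂-23 : ∀ {v} → v < n₃ → O₂ (suc n₃) v ≡ + 2
    O₂-23 q = trans (collapse-last-inner a₂ (suc n₃) O₁ _ (ℕP.m<n⇒m<1+n q))
      (trans (O₁-HH (<n₂⇒<k (ℕP.n<1+n a₂)) (<n₃⇒n₂+<k q)) (Ψ₂₃ (ℕP.n<1+n a₂) q))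

    O₂-21 : O₂ (suc n₃) n₃ ≡ + n₁ *ℤ + 1
    O₂-21 = trans (collapse-last-inner a₂ (suc n₃) O₁ n₃ (ℕP.n<1+n n₃)) (O₁-H1 (<n₂⇒<k (ℕP.n<1+n a₂)))

    O₂-22 : O₂ (suc n₃) (suc n₃) ≡ d₂ +ℤ + n₂ *ℤ + 2
    O₂-22 = trans (collapse-last-last a₂ (suc n₃) O₁)
      (trans (∑-offset n₂ (+ 2) (λ t q → trans (O₁-HH (<n₂⇒<k (ℕP.n<1+n a₂)) (<n₂⇒<k q)) (Ψ₂₂ (ℕP.n<1+n a₂) q)))
             (cong (_+ℤ + n₂ *ℤ + 2) (C₂-rowSum (ℕP.n<1+n a₂))))

    -- the indices 0, 1, 2 of O₃ are the collapsed G₁, G₂, G₃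
    O₃ : Mat
    O₃ = collapse a₃ 2 O₂

    n₃+0 : n₃ + 0 ≡ n₃
    n₃+0 = ℕP.+-identityʳ n₃

    n₃+1 : n₃ + 1 ≡ suc n₃
    n₃+1 = ℕP.+-comm n₃ 1

    collapse₃ : det′ (2 + n₃) O₂ *ℤ d₂ ≡ det′ n₃ C₃′ *ℤ det′ 3 O₃
    collapse₃ = trans (cong (λ m → det′ (suc m) O₂ *ℤ d₂) (ℕP.+-comm 2 a₃))
      (det′-collapse a₃ 2 O₂ C₃′ (+ 2) d₂ equalRows (λ u v → O₂-33) (λ u → C₃-rowSum))
      where
      equalRows : ∀ u w → u < a₃ → w < 2 → O₂ u (n₃ + w) ≡ O₂ (suc u) (n₃ + w)
      equalRows u zero u<a₃ _ = subst (λ c → O₂ u c ≡ O₂ (suc u) c) (sym n₃+0)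
        (trans (O₂-31 (ℕP.m<n⇒m<1+n u<a₃)) (sym (O₂-31 (s≤s u<a₃))))
      equalRows u (suc zero) u<a₃ _ = subst (λ c → O₂ u c ≡ O₂ (suc u) c) (sym n₃+1)
        (trans (O₂-32 (ℕP.m<n⇒m<1+n u<a₃)) (sym (O₂-32 (s≤s u<a₃))))
      equalRows u (suc (suc w)) _ (s≤s (s≤s ()))

    0<2 : 0 < 2
    0<2 = s≤s z≤n

    1<2 : 1 < 2
    1<2 = s≤s (s≤s z≤n)

    O₃-00 : O₃ 0 0 ≡ d₁ +ℤ + n₁ *ℤ + 2
    O₃-00 = trans (collapse-inner a₃ 2 O₂ 0 0 0<2 0<2) (trans (cong₂ O₂ n₃+0 n₃+0) O₂-11)

    O₃-01 : O₃ 0 1 ≡ + n₂ *ℤ + 1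
    O₃-01 = trans (collapse-inner a₃ 2 O₂ 0 1 0<2 1<2) (trans (cong₂ O₂ n₃+0 n₃+1) O₂-12)

    O₃-02 : O₃ 0 2 ≡ + n₃ *ℤ + 1
    O₃-02 = trans (collapse-inner-last a₃ 2 O₂ 0 0<2)
      (trans (cong (λ c → ∑ n₃ (O₂ c)) n₃+0) (∑-constant n₃ (+ 1) (λ t → O₂-13)))

    O₃-10 : O₃ 1 0 ≡ + n₁ *ℤ + 1
    O₃-10 = trans (collapse-inner a₃ 2 O₂ 1 0 1<2 0<2) (trans (cong₂ O₂ n₃+1 n₃+0) O₂-21)

    O₃-11 : O₃ 1 1 ≡ d₂ +ℤ + n₂ *ℤ + 2
    O₃-11 = trans (collapse-inner a₃ 2 O₂ 1 1 1<2 1<2) (trans (cong₂ O₂ n₃+1 n₃+1) O₂-22)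

    O₃-12 : O₃ 1 2 ≡ + n₃ *ℤ + 2
    O₃-12 = trans (collapse-inner-last a₃ 2 O₂ 1 1<2)
      (trans (cong (λ c → ∑ n₃ (O₂ c)) n₃+1) (∑-constant n₃ (+ 2) (λ t → O₂-23)))

    O₃-20 : O₃ 2 0 ≡ + n₁ *ℤ + 1
    O₃-20 = trans (collapse-last-inner a₃ 2 O₂ 0 0<2) (trans (cong (O₂ a₃) n₃+0) (O₂-31 (ℕP.n<1+n a₃)))

    O₃-21 : O₃ 2 1 ≡ + n₂ *ℤ + 2
    O₃-21 = trans (collapse-last-inner a₃ 2 O₂ 1 1<2) (trans (cong (O₂ a₃) n₃+1) (O₂-32 (ℕP.n<1+n a₃)))

    O₃-22 : O₃ 2 2 ≡ d₂ +ℤ + n₃ *ℤ + 2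
    O₃-22 = trans (collapse-last-last a₃ 2 O₂)
      (trans (∑-offset n₃ (+ 2) (λ t → O₂-33 (ℕP.n<1+n a₃))) (cong (_+ℤ + n₃ *ℤ + 2) (C₃-rowSum (ℕP.n<1+n a₃))))

    det′-O₃ : det′ 3 O₃ ≡ x *ℤ (x - + (n₁ + n₂ + n₃)) *ℤ d₂
    det′-O₃ = trans (det′-3 O₃) (trans expanded (cong (λ n → x *ℤ (x - n) *ℤ d₂) (sym (cast₀ n₁ n₂ n₃))))
      where
      cast₀ : ∀ a b c → + (a + b + c) ≡ + a +ℤ + b +ℤ + c
      cast₀ a b c = trans (ℤP.pos-+ (a + b) c) (cong (_+ℤ + c) (ℤP.pos-+ a b))

      cast₁ : ∀ a b c → + (2 * a + b + c) ≡ + 2 *ℤ + a +ℤ + b +ℤ + c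
      cast₁ a b c = trans (ℤP.pos-+ (2 * a + b) c) (cong (_+ℤ + c) (trans (ℤP.pos-+ (2 * a) b) (cong (_+ℤ + b) (ℤP.pos-* 2 a))))

      cast₂ : ∀ a b c → + (a + 2 * b + 2 * c) ≡ + a +ℤ + 2 *ℤ + b +ℤ + 2 *ℤ + c
      cast₂ a b c = trans (ℤP.pos-+ (a + 2 * b) (2 * c))
        (cong₂ _+ℤ_ (trans (ℤP.pos-+ a (2 * b)) (cong (_+ℤ_ (+ a)) (ℤP.pos-* 2 b))) (ℤP.pos-* 2 c))

      K = O₃
      expanded : K 0 0 *ℤ (K 1 1 *ℤ K 2 2 - K 1 2 *ℤ K 2 1) - K 0 1 *ℤ (K 1 0 *ℤ K 2 2 - K 1 2 *ℤ K 2 0)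
                   +ℤ K 0 2 *ℤ (K 1 0 *ℤ K 2 1 - K 1 1 *ℤ K 2 0)
               ≡ x *ℤ (x - (+ n₁ +ℤ + n₂ +ℤ + n₃)) *ℤ d₂
      expanded rewrite O₃-00 | O₃-01 | O₃-02 | O₃-10 | O₃-11 | O₃-12 | O₃-20 | O₃-21 | O₃-22 =
        quotient (+ n₁) (+ n₂) (+ n₃) (cong (_-_ x) (cast₁ n₁ n₂ n₃)) (cong (_-_ x) (cast₂ n₁ n₂ n₃))
        where
        quotient : ∀ a b c {d₁ d₂} → d₁ ≡ x - (+ 2 *ℤ a +ℤ b +ℤ c) → d₂ ≡ x - (a +ℤ + 2 *ℤ b +ℤ + 2 *ℤ c) →
          (d₁ +ℤ a *ℤ + 2) *ℤ ((d₂ +ℤ b *ℤ + 2) *ℤ (d₂ +ℤ c *ℤ + 2) - c *ℤ + 2 *ℤ (b *ℤ + 2))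
          - b *ℤ + 1 *ℤ (a *ℤ + 1 *ℤ (d₂ +ℤ c *ℤ + 2) - c *ℤ + 2 *ℤ (a *ℤ + 1))
          +ℤ c *ℤ + 1 *ℤ (a *ℤ + 1 *ℤ (b *ℤ + 2) - (d₂ +ℤ b *ℤ + 2) *ℤ (a *ℤ + 1))
          ≡ x *ℤ (x - (a +ℤ b +ℤ c)) *ℤ d₂
        quotient a b c refl refl = polynomial x a b c
          where
          polynomial : ∀ (x a b c : ℤ) →
            (x - (+ 2 *ℤ a +ℤ b +ℤ c) +ℤ a *ℤ + 2) *ℤ ((x - (a +ℤ + 2 *ℤ b +ℤ + 2 *ℤ c) +ℤ b *ℤ + 2) *ℤ (x - (a +ℤ + 2 *ℤ b +ℤ + 2 *ℤ c) +ℤ c *ℤ + 2) - c *ℤ + 2 *ℤ (b *ℤ + 2))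
            - b *ℤ + 1 *ℤ (a *ℤ + 1 *ℤ (x - (a +ℤ + 2 *ℤ b +ℤ + 2 *ℤ c) +ℤ c *ℤ + 2) - c *ℤ + 2 *ℤ (a *ℤ + 1))
            +ℤ c *ℤ + 1 *ℤ (a *ℤ + 1 *ℤ (b *ℤ + 2) - (x - (a +ℤ + 2 *ℤ b +ℤ + 2 *ℤ c) +ℤ b *ℤ + 2) *ℤ (a *ℤ + 1))
            ≡ x *ℤ (x - (a +ℤ b +ℤ c)) *ℤ (x - (a +ℤ + 2 *ℤ b +ℤ + 2 *ℤ c))
          polynomial = solve-∀

    det′-Ψ : det′ N Ψ *ℤ d₁ *ℤ d₂ *ℤ d₂ ≡
      x *ℤ (x - + (n₁ + n₂ + n₃)) *ℤ d₂ *ℤ det′ n₁ C₁′ *ℤ det′ n₂ C₂′ *ℤ det′ n₃ C₃′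
    det′-Ψ = begin
      det′ N Ψ *ℤ d₁ *ℤ d₂ *ℤ d₂
        ≡⟨ cong (λ z → z *ℤ d₂ *ℤ d₂) collapse₁ ⟩
      det′ n₁ C₁′ *ℤ det′ (suc k) O₁ *ℤ d₂ *ℤ d₂
        ≡⟨ reassoc₁ (det′ n₁ C₁′) _ d₂ d₂ ⟩
      det′ n₁ C₁′ *ℤ (det′ (suc k) O₁ *ℤ d₂) *ℤ d₂
        ≡⟨ cong (λ z → det′ n₁ C₁′ *ℤ z *ℤ d₂) collapse₂ ⟩
      det′ n₁ C₁′ *ℤ (det′ n₂ C₂′ *ℤ det′ (2 + n₃) O₂) *ℤ d₂
        ≡⟨ reassoc₂ (det′ n₁ C₁′) (det′ n₂ C₂′) _ d₂ ⟩
      det′ n₁ C₁′ *ℤ det′ n₂ C₂′ *ℤ (det′ (2 + n₃) O₂ *ℤ d₂)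
        ≡⟨ cong (λ z → det′ n₁ C₁′ *ℤ det′ n₂ C₂′ *ℤ z) collapse₃ ⟩
      det′ n₁ C₁′ *ℤ det′ n₂ C₂′ *ℤ (det′ n₃ C₃′ *ℤ det′ 3 O₃)
        ≡⟨ cong (λ z → det′ n₁ C₁′ *ℤ det′ n₂ C₂′ *ℤ (det′ n₃ C₃′ *ℤ z)) det′-O₃ ⟩
      det′ n₁ C₁′ *ℤ det′ n₂ C₂′ *ℤ (det′ n₃ C₃′ *ℤ (x *ℤ (x - + (n₁ + n₂ + n₃)) *ℤ d₂))
        ≡⟨ reorder (det′ n₁ C₁′) (det′ n₂ C₂′) (det′ n₃ C₃′) _ ⟩
      x *ℤ (x - + (n₁ + n₂ + n₃)) *ℤ d₂ *ℤ det′ n₁ C₁′ *ℤ det′ n₂ C₂′ *ℤ det′ n₃ C₃′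
        ∎
      where
      reassoc₁ : ∀ (a b c d : ℤ) → a *ℤ b *ℤ c *ℤ d ≡ a *ℤ (b *ℤ c) *ℤ d
      reassoc₁ = solve-∀
      reassoc₂ : ∀ (a b c d : ℤ) → a *ℤ (b *ℤ c) *ℤ d ≡ a *ℤ b *ℤ (c *ℤ d)
      reassoc₂ = solve-∀
      reorder : ∀ (a b c t : ℤ) → a *ℤ b *ℤ (c *ℤ t) ≡ t *ℤ a *ℤ b *ℤ c
      reorder = solve-∀

    charPoly-join : det N Φ *ℤ d₁ *ℤ d₂ *ℤ d₂ ≡
      x *ℤ (x - + (n₁ + n₂ + n₃)) *ℤ d₂ *ℤ det n₁ C₁ *ℤ det n₂ C₂ *ℤ det n₃ C₃
    charPoly-join rewrite det≡det′-toMat N Φ | det≡det′-toMat n₁ C₁ | det≡det′-toMat n₂ C₂ | det≡det′-toMat n₃ C₃ = det′-Ψ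

theorem3p15 : (n₁ n₂ n₃ r₁ r₂ r₃ : ℕ) → 1 ≤ n₁ → 1 ≤ n₂ → 1 ≤ n₃ →
    (G₁ : AdjRel n₁) (G₂ : AdjRel n₂) (G₃ : AdjRel n₃) →
    IsSimple G₁ → IsSimple G₂ → IsSimple G₃ →
    IsRegular G₁ r₁ → IsRegular G₂ r₂ → IsRegular G₃ r₃ →
    (x : ℤ) →
      charPoly (distLaplacian (join G₁ (union G₂ G₃)))  x
        *ℤ (x - + (2 * n₁ + n₂ + n₃))
        *ℤ (x - + (n₁ + 2 * n₂ + 2 * n₃))
        *ℤ (x - + (n₁ + 2 * n₂ + 2 * n₃))
      ≡ x *ℤ (x - + (n₁ + n₂ + n₃))
          *ℤ (x - + (n₁ + 2 * n₂ + 2 * n₃))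
          *ℤ charPoly (adjMatrix G₁) (x - + (2 * n₁ + n₂ + n₃) +ℤ + r₁)
          *ℤ charPoly (adjMatrix G₂) (x - + (n₁ + 2 * n₂ + 2 * n₃) +ℤ + r₂)
          *ℤ charPoly (adjMatrix G₃) (x - + (n₁ + 2 * n₂ + 2 * n₃) +ℤ + r₃)
theorem3p15 zero    _       _       _ _ _ () _  _
theorem3p15 (suc _) zero    _       _ _ _ _  () _
theorem3p15 (suc _) (suc _) zero    _ _ _ _  _  ()
theorem3p15 (suc _) (suc _) (suc _) _ _ _ _ _ _ G₁ G₂ G₃ S₁ S₂ S₃ R₁ R₂ R₃ x =
  JoinOfUnion.charPoly-join G₁ G₂ G₃ S₁ S₂ S₃ R₁ R₂ R₃ x
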